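{- (i) For integers $n,t$ with $t\geq 1$ and $n-3-t\geq 1$, $ABC_3(H^t(n,3;n-3-t,0,0))=(n-1)\sqrt{\tfrac12}+f(3,3)$. (ii) For integers $n,k,t$ with $t\geq 2$, $k\geq 4$ and $n-k-t\geq 1$, $ABC_3(H^t(n,k;n-k-t,0,\ldots,0))<ABC_3(H^1(n,k;n-k-1,0,\ldots,0))$.
   Context: All graphs are simple and connected. For a vertex $u$ of a graph $G$, the eccentricity $e_G(u)$ is $\max\{d_G(u,v): v\in V(G)\}$, where $d_G$ is the shortest-path distance. For real $x,y\geq 1$, $f(x,y)=\sqrt{\frac{x+y-2}{xy}}$, and $ABC_3(G)=\sum_{uv\in E(G)} f(e_G(u),e_G(v))$. For integers $k\geq 3$ and $m\geq1$ and $t\geq 1$, with $n=k+m+t$, $H^t(n,k;m,0,\ldots,0)$ denotes the graph of order $n$ obtained from the cycle $C_k=v_1v_2\cdots v_kv_1$ by attaching $m$ new pendent vertices to $v_1$ and then attaching $t$ further new pendent vertices to one of those $m$ pendent vertices (equivalently, identifying one pendent vertex adjacent to $v_1$ with the center of a star on $t+1$ vertices). -}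

module Defs where

open import Data.Bool using (Bool; true; false; _∧_; _∨_; not; if_then_else_)
open import Data.Nat as ℕ using (ℕ; zero; suc; _∸_; _⊔_; _<ᵇ_; _≡ᵇ_)
open import Data.Fin as Fin using (Fin; toℕ)
open import Data.Fin.Properties using (_≟_)
open import Data.List using (List; []; _∷_; map; foldr; concatMap; allFin; upTo; length; filterᵇ)
open import Data.List.Relation.Binary.Pointwise using (Pointwise)
open import Data.Integer using (+_)
open import Data.Rational as ℚ using (ℚ; 0ℚ; _/_)
open import Data.Product using (Σ; _×_)
open import Relation.Nullary using (¬_)
open import Data.Bool.ListAction using (any)
open import Relation.Nullary.Decidable using (⌊_⌋)

record Graph : Set where
  field
    order : ℕ
    adj   : Fin order → Fin order → Bool

open Graph public

module _ (G : Graph) where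
  private
    n = order G
    V = allFin n

  reach : ℕ → Fin n → Fin n → Bool
  reach zero    u v = ⌊ u ≟ v ⌋
  reach (suc k) u v = reach k u v ∨ any (λ w → adj G u w ∧ reach k w v) V

  -- shortest-path distance d_G(u,v) = least k with reach k u v
  -- (reach is monotone in k, so this counts the k < n with no walk of length ≤ k;
  --  for a connected graph this is exactly the shortest-path distance)
  dist : Fin n → Fin n → ℕ
  dist u v = length (filterᵇ (λ k → not (reach k u v)) (upTo n))

  ecc : Fin n → ℕ
  ecc u = foldr _⊔_ 0 (map (dist u) V)

-- f(x,y)^2 = (x+y-2)/(xy) for x,y ≥ 1 (the value at 0 is irrelevant: never used,
-- eccentricities in a connected graph with ≥ 2 vertices are ≥ 1).

fsq : ℕ → ℕ → ℚ
fsq zero    _       = 0ℚ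
fsq (suc _) zero    = 0ℚ
fsq (suc a) (suc b) = (+ (a ℕ.+ b)) / (suc a ℕ.* suc b)

-- ABC_3(G) = Σ_{uv ∈ E(G)} f(e(u),e(v)) = Σ_{uv ∈ E(G)} √(fsq (e u) (e v)).
-- We record it as the list of radicands (one per edge uv with u < v);
-- its real value is the sum of the square roots of the entries.
ABC3-radicands : Graph → List ℚ
ABC3-radicands G =
  concatMap (λ i → concatMap (λ j →
      if (toℕ i <ᵇ toℕ j) ∧ adj G i j
      then fsq (ecc G i) (ecc G j) ∷ []
      else []) (allFin (order G))) (allFin (order G))

-- Real numbers of the form Σ_i √q_i (q_i ≥ 0 rationals), compared with
-- rationals Dedekind-style, since the standard library has no reals.

ℚsum : List ℚ → ℚ
ℚsum = foldr ℚ._+_ 0ℚ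

_<√Σ_ : ℚ → List ℚ → Set
r <√Σ qs = Σ (List ℚ) λ as →
  Pointwise (λ a q → (0ℚ ℚ.≤ a) × (a ℚ.* a ℚ.≤ q)) as qs × (r ℚ.< ℚsum as)

_√Σ<_ : List ℚ → ℚ → Set
qs √Σ< r = Σ (List ℚ) λ bs →
  Pointwise (λ b q → (0ℚ ℚ.≤ b) × (q ℚ.≤ b ℚ.* b)) bs qs × (ℚsum bs ℚ.< r)

_√<_ : List ℚ → List ℚ → Set
ps √< qs = Σ ℚ λ r → (ps √Σ< r) × (r <√Σ qs)

_√≈_ : List ℚ → List ℚ → Set
ps √≈ qs = ¬ (ps √< qs) × ¬ (qs √< ps)

-- H^t(n,k;m,0,…,0) with n = k+m+t.  Vertex labels (as naturals):
--   0 … k-1      : the cycle v_1 … v_k  (label 0 = v_1)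
--   k … k+m-1    : the m pendent vertices at v_1 (label k = the chosen one, w)
--   k+m … n-1    : the t pendent vertices attached to w

Hedge : ℕ → ℕ → ℕ → ℕ → ℕ → Bool
Hedge k m t a b =
     ((b <ᵇ k) ∧ ((b ≡ᵇ suc a) ∨ ((a ≡ᵇ 0) ∧ (b ≡ᵇ (k ∸ 1))) ) ∧ (a <ᵇ b))
  ∨ ((a ≡ᵇ 0) ∧ (k ℕ.≤ᵇ b) ∧ (b <ᵇ k ℕ.+ m))
  ∨ ((a ≡ᵇ k) ∧ (k ℕ.+ m ℕ.≤ᵇ b) ∧ (b <ᵇ k ℕ.+ m ℕ.+ t))

H : (k m t : ℕ) → Graph
H k m t = record
  { order = k ℕ.+ m ℕ.+ t
  ; adj   = λ i j → Hedge k m t (toℕ i) (toℕ j) ∨ Hedge k m t (toℕ j) (toℕ i)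
  }

module Submission where

-- In H^t(n,k;m,0,…,0) all distances are explicit: two cycle vertices are at cyclic distance, and the
-- hub w (the pendant vertex carrying the star), the other pendant vertices at v₁ and the leaves at w
-- hang at depth 1, 1 and 2 below v₁.  Hence all eccentricities are explicit, those off the cycle
-- being e₀ + 1, max(e₀ + 1, 3) and e₀ + 2 where e₀ is the eccentricity of v₁ on the cycle, and the
-- radicands of ABC₃ form an explicit list: the edges at v₁, the cycle edges, and t hub–leaf edges
-- with radicand f(e₀+1, e₀+2)².  For k = 3 every radicand but that of v₂v₃ equals 1/2.  Passing
-- from H^t to H^1 turns t - 1 hub–leaf edges into pendant edges at v₁ with radicand f(e₀, e₀+1)²,
-- which is strictly larger once e₀ ≥ 2, i.e. k ≥ 4.
--
-- Sums of square roots are compared through rational lower and upper bounds of the roots: such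
-- comparisons are invariant under permuting the radicands, and a strictly larger radicand wins on a
-- fine enough grid.

open import Defs
open import Data.Bool using (Bool; true; false; _∧_; _∨_; not; if_then_else_; T)
open import Data.Bool.ListAction using (any)
open import Data.Nat using (ℕ; zero; suc; pred; _+_; _*_; _∸_; _≤_; _<_; _⊔_; _⊓_; _<ᵇ_; _≤ᵇ_; _≡ᵇ_; z≤n; s≤s)
open import Data.Nat.Properties renaming (_≟_ to _≟ℕ_)
open import Data.Nat.ListAction using (sum)
open import Data.Nat.Tactic.RingSolver using (solve-∀)
open import Data.Integer as ℤ using (+_; -[1+_]; +≤+; +<+)
import Data.Integer.Properties as ℤP
open import Data.Rational as ℚ using (ℚ; mkℚ; _/_; 0ℚ; toℚᵘ)
import Data.Rational.Properties as ℚP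
open import Data.Rational.Unnormalised as ℚᵘ using (mkℚᵘ; *≤*; *<*; *≡*)
import Data.Rational.Unnormalised.Properties as ℚᵘP
open import Data.Fin using (Fin; toℕ; fromℕ<)
import Data.Fin as Fin
open import Data.Fin.Properties using (_≟_; toℕ-injective; toℕ<n; toℕ-fromℕ<)
open import Data.List using (List; []; _∷_; [_]; _++_; map; foldr; concatMap; replicate; length; filterᵇ; applyUpTo; upTo; allFin; tabulate)
import Data.List.Properties as ListP
open import Data.List.Membership.Propositional using (_∈_)
open import Data.List.Membership.Propositional.Properties using (∈-allFin)
open import Data.List.Relation.Unary.Any using (here; there)
open import Data.List.Relation.Unary.All using (All; []; _∷_)
import Data.List.Relation.Unary.All.Properties as AllP
open import Data.List.Relation.Binary.Pointwise using (Pointwise; []; _∷_)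
import Data.List.Relation.Binary.Permutation.Propositional as ↭
open import Data.List.Relation.Binary.Permutation.Propositional using (_↭_; ↭-trans; ↭-sym; ↭-reflexive; ↭⇒↭ₛ)
open import Data.List.Relation.Binary.Permutation.Propositional.Properties using (shift; shifts; ∷↭∷ʳ; ++-comm)
open import Data.List.Relation.Binary.Permutation.Setoid.Properties using (foldr-commMonoid)
open import Data.Product using (∃-syntax; _,_; proj₁; proj₂; _×_)
open import Data.Sum using (_⊎_; inj₁; inj₂)
open import Data.Empty using (⊥; ⊥-elim)
open import Function using (_∘′_; case_of_)
open import Relation.Binary.PropositionalEquality hiding ([_])
open import Relation.Nullary using (yes; no; ¬_; Dec; contradiction)

T⇒≡true : ∀ {b} → T b → b ≡ true
T⇒≡true {true} _ = refl

¬T⇒≡false : ∀ {b} → ¬ T b → b ≡ false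
¬T⇒≡false {false} _  = refl
¬T⇒≡false {true}  ¬t = ⊥-elim (¬t _)

≡true⇒T : ∀ {b} → b ≡ true → T b
≡true⇒T refl = _

∧-true⁻ : ∀ a {b} → a ∧ b ≡ true → (a ≡ true) × (b ≡ true)
∧-true⁻ true e = refl , e

∧-true⁺ : ∀ {a b} → a ≡ true → b ≡ true → a ∧ b ≡ true
∧-true⁺ refl e = e

∨-true⁻ : ∀ a {b} → a ∨ b ≡ true → (a ≡ true) ⊎ (b ≡ true)
∨-true⁻ true  _ = inj₁ refl
∨-true⁻ false e = inj₂ e

∨-trueˡ : ∀ {a} b → a ≡ true → a ∨ b ≡ true
∨-trueˡ b refl = refl

∨-trueʳ : ∀ a {b} → b ≡ true → a ∨ b ≡ true
∨-trueʳ true  _ = refl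
∨-trueʳ false e = e

<ᵇ-true : ∀ {a b} → a < b → (a <ᵇ b) ≡ true
<ᵇ-true a<b = T⇒≡true (<⇒<ᵇ a<b)

<ᵇ-false : ∀ {a b} → b ≤ a → (a <ᵇ b) ≡ false
<ᵇ-false {a} {b} b≤a = ¬T⇒≡false (λ t → <⇒≱ (<ᵇ⇒< a b t) b≤a)

≤ᵇ-true : ∀ {a b} → a ≤ b → (a ≤ᵇ b) ≡ true
≤ᵇ-true a≤b = T⇒≡true (≤⇒≤ᵇ a≤b)

≤ᵇ-false : ∀ {a b} → b < a → (a ≤ᵇ b) ≡ false
≤ᵇ-false {a} {b} b<a = ¬T⇒≡false (λ t → <⇒≱ b<a (≤ᵇ⇒≤ a b t))

≡ᵇ-true : ∀ {a b} → a ≡ b → (a ≡ᵇ b) ≡ true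
≡ᵇ-true {a} {b} a≡b = T⇒≡true (≡⇒≡ᵇ a b a≡b)

≡ᵇ-false : ∀ {a b} → a ≢ b → (a ≡ᵇ b) ≡ false
≡ᵇ-false {a} {b} a≢b = ¬T⇒≡false (λ t → a≢b (≡ᵇ⇒≡ a b t))

<ᵇ-true⁻ : ∀ {a b} → (a <ᵇ b) ≡ true → a < b
<ᵇ-true⁻ {a} {b} e = <ᵇ⇒< a b (≡true⇒T e)

≤ᵇ-true⁻ : ∀ {a b} → (a ≤ᵇ b) ≡ true → a ≤ b
≤ᵇ-true⁻ {a} {b} e = ≤ᵇ⇒≤ a b (≡true⇒T e)

≡ᵇ-true⁻ : ∀ {a b} → (a ≡ᵇ b) ≡ true → a ≡ b
≡ᵇ-true⁻ {a} {b} e = ≡ᵇ⇒≡ a b (≡true⇒T e)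

≡ᵇ-refl : ∀ x → (x ≡ᵇ x) ≡ true
≡ᵇ-refl x = ≡ᵇ-true {x} refl

any-true⁺ : ∀ {A : Set} (p : A → Bool) {xs x} → x ∈ xs → p x ≡ true → any p xs ≡ true
any-true⁺ p (here refl) e rewrite e = refl
any-true⁺ p {y ∷ _} (there x∈xs) e = ∨-trueʳ (p y) (any-true⁺ p x∈xs e)

any-true⁻ : ∀ {A : Set} (p : A → Bool) xs → any p xs ≡ true → ∃[ x ] p x ≡ true
any-true⁻ p (y ∷ xs) e with p y in py
... | true  = y , py
... | false = any-true⁻ p xs e

interval : ℕ → ℕ → List ℕ
interval s zero    = []
interval s (suc l) = s ∷ interval (suc s) l

applyUpTo≡interval : ∀ n (f : ℕ → ℕ) s → (∀ i → f i ≡ s + i) → applyUpTo f n ≡ interval s n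
applyUpTo≡interval zero    f s h = refl
applyUpTo≡interval (suc n) f s h = cong₂ _∷_ (trans (h 0) (+-identityʳ s))
  (applyUpTo≡interval n (f ∘′ suc) (suc s) (λ i → trans (h (suc i)) (+-suc s i)))

upTo≡interval : ∀ n → upTo n ≡ interval 0 n
upTo≡interval n = applyUpTo≡interval n (λ i → i) 0 (λ i → refl)

tabulate≡interval : ∀ n (f : Fin n → ℕ) s → (∀ i → f i ≡ s + toℕ i) → tabulate f ≡ interval s n
tabulate≡interval zero    f s h = refl
tabulate≡interval (suc n) f s h = cong₂ _∷_ (trans (h Fin.zero) (+-identityʳ s))
  (tabulate≡interval n (λ i → f (Fin.suc i)) (suc s) (λ i → trans (h (Fin.suc i)) (+-suc s (toℕ i))))

map-toℕ-allFin : ∀ n → map toℕ (allFin n) ≡ interval 0 n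
map-toℕ-allFin n = trans (ListP.map-tabulate (λ i → i) toℕ) (tabulate≡interval n toℕ 0 (λ i → refl))

∈-interval⁻ : ∀ s l {x} → x ∈ interval s l → (s ≤ x) × (x < s + l)
∈-interval⁻ s (suc l) (here refl) = ≤-refl , subst (s <_) (sym (+-suc s l)) (s≤s (m≤m+n s l))
∈-interval⁻ s (suc l) {x} (there x∈) with ∈-interval⁻ (suc s) l x∈
... | s<x , x<s+l = ≤-trans (n≤1+n s) s<x , subst (x <_) (sym (+-suc s l)) x<s+l

∈-interval⁺ : ∀ s l {x} → s ≤ x → x < s + l → x ∈ interval s l
∈-interval⁺ s zero    s≤x x<s = ⊥-elim (<-irrefl refl (≤-trans x<s (subst (_≤ _) (sym (+-identityʳ s)) s≤x)))
∈-interval⁺ s (suc l) {x} s≤x x<s+l with s ≟ℕ x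
... | yes refl = here refl
... | no  s≢x  = there (∈-interval⁺ (suc s) l (≤∧≢⇒< s≤x s≢x) (subst (x <_) (+-suc s l) x<s+l))

interval-++ : ∀ s a b → interval s (a + b) ≡ interval s a ++ interval (s + a) b
interval-++ s zero    b = cong (λ z → interval z b) (sym (+-identityʳ s))
interval-++ s (suc a) b = cong (s ∷_) (trans (interval-++ (suc s) a b)
  (cong (λ z → interval (suc s) a ++ interval z b) (sym (+-suc s a))))

concatMap-cong-interval : ∀ {B : Set} (f g : ℕ → List B) s l → (∀ b → s ≤ b → b < s + l → f b ≡ g b) →
                          concatMap f (interval s l) ≡ concatMap g (interval s l)
concatMap-cong-interval f g s zero    f≗g = refl
concatMap-cong-interval f g s (suc l) f≗g =
  cong₂ _++_ (f≗g s ≤-refl (subst (s <_) (sym (+-suc s l)) (s≤s (m≤m+n s l))))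
    (concatMap-cong-interval f g (suc s) l
      (λ b s<b b<s+l → f≗g b (≤-trans (n≤1+n s) s<b) (subst (b <_) (sym (+-suc s l)) b<s+l)))

concatMap-nil : ∀ {B : Set} s l → concatMap (λ (_ : ℕ) → [] {A = B}) (interval s l) ≡ []
concatMap-nil s zero    = refl
concatMap-nil s (suc l) = concatMap-nil (suc s) l

concatMap-const : ∀ {B : Set} (c : B) s l → concatMap (λ _ → c ∷ []) (interval s l) ≡ replicate l c
concatMap-const c s zero    = refl
concatMap-const c s (suc l) = cong (c ∷_) (concatMap-const c (suc s) l)

interval-split : ∀ s a b l → a + b ≡ l → interval s l ≡ interval s a ++ interval (s + a) b
interval-split s a b l refl = interval-++ s a b

length-filter-prefix : (p : ℕ → Bool) (D : ℕ) → ∀ n s → (∀ i → p (s + i) ≡ (i <ᵇ D)) → D ≤ n →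
                       length (filterᵇ p (interval s n)) ≡ D
length-filter-prefix p zero    zero    s h _ = refl
length-filter-prefix p zero    (suc n) s h _ rewrite trans (cong p (sym (+-identityʳ s))) (h 0) =
  length-filter-prefix p zero n (suc s) (λ i → trans (cong p (sym (+-suc s i))) (h (suc i))) z≤n
length-filter-prefix p (suc D) (suc n) s h (s≤s D≤n) rewrite trans (cong p (sym (+-identityʳ s))) (h 0) =
  cong suc (length-filter-prefix p D n (suc s) (λ i → trans (cong p (sym (+-suc s i))) (h (suc i))) D≤n)

maxOf : ∀ {A : Set} → (A → ℕ) → List A → ℕ
maxOf f xs = foldr _⊔_ 0 (map f xs)

maxOf-≥ : ∀ {A : Set} (f : A → ℕ) {xs x} → x ∈ xs → f x ≤ maxOf f xs
maxOf-≥ f (here refl)  = m≤m⊔n (f _) _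
maxOf-≥ f {y ∷ _} (there x∈xs) = ≤-trans (maxOf-≥ f x∈xs) (m≤n⊔m (f y) _)

maxOf-≤ : ∀ {A : Set} (f : A → ℕ) xs {E} → (∀ {x} → x ∈ xs → f x ≤ E) → maxOf f xs ≤ E
maxOf-≤ f []       h = z≤n
maxOf-≤ f (y ∷ xs) h = ⊔-lub (h (here refl)) (maxOf-≤ f xs (λ x∈ → h (there x∈)))

maxOf-attained : ∀ {A : Set} (f : A → ℕ) y xs → ∃[ x ] (x ∈ y ∷ xs) × (f x ≡ maxOf f (y ∷ xs))
maxOf-attained f y []       = y , here refl , sym (⊔-identityʳ (f y))
maxOf-attained f y (z ∷ xs) with maxOf-attained f z xs | ⊔-sel (f y) (maxOf f (z ∷ xs))
... | _ , _   , _  | inj₁ e = y , here refl , sym e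
... | x , x∈ , fx | inj₂ e = x , there x∈ , trans fx (sym e)

-- Distances certified by a potential

record DistanceTo (G : Graph) (v : Fin (order G)) : Set where
  field
    φ          : Fin (order G) → ℕ
    φ-target   : φ v ≡ 0
    φ≡0⇒target : ∀ x → φ x ≡ 0 → x ≡ v
    φ-edge     : ∀ x y → adj G x y ≡ true → φ x ≤ suc (φ y)
    φ-descent  : ∀ x j → φ x ≡ suc j → ∃[ y ] (adj G x y ≡ true) × (φ y ≡ j)
    φ-bounded  : ∀ x → φ x ≤ order G

module _ (G : Graph) where

  reach-mono : ∀ i j u v → reach G j u v ≡ true → reach G (i + j) u v ≡ true
  reach-mono zero    j u v e = e
  reach-mono (suc i) j u v e rewrite reach-mono i j u v e = refl

  module _ {v : Fin (order G)} (P : DistanceTo G v) where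
    open DistanceTo P

    reach⇒φ≤ : ∀ j u → reach G j u v ≡ true → φ u ≤ j
    reach⇒φ≤ zero u e with u ≟ v
    ... | yes refl = ≤-reflexive φ-target
    reach⇒φ≤ (suc j) u e with reach G j u v in e′
    ... | true  = ≤-trans (reach⇒φ≤ j u e′) (n≤1+n j)
    ... | false with any-true⁻ _ (allFin (order G)) e
    ... | w , e″ with ∧-true⁻ (adj G u w) e″
    ... | uw , wv = ≤-trans (φ-edge u w uw) (s≤s (reach⇒φ≤ j w wv))

    φ≡⇒reach : ∀ j u → φ u ≡ j → reach G j u v ≡ true
    φ≡⇒reach zero u e with φ≡0⇒target u e
    ... | refl with u ≟ u
    ... | yes _ = refl
    ... | no u≢u = ⊥-elim (u≢u refl)
    φ≡⇒reach (suc j) u e with φ-descent u j e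
    ... | w , uw , e′ = ∨-trueʳ (reach G j u v)
      (any-true⁺ _ (∈-allFin w) (subst (λ b → b ∧ reach G j w v ≡ true) (sym uw) (φ≡⇒reach j w e′)))

    dist≡φ : ∀ u → dist G u v ≡ φ u
    dist≡φ u = trans (cong (λ l → length (filterᵇ (λ k → not (reach G k u v)) l)) (upTo≡interval (order G)))
      (length-filter-prefix (λ k → not (reach G k u v)) (φ u) (order G) 0 unreachable (φ-bounded u))
      where
      unreachable : ∀ i → not (reach G i u v) ≡ (i <ᵇ φ u)
      unreachable i with i <? φ u
      ... | yes i<φ rewrite T⇒≡true (<⇒<ᵇ i<φ) with reach G i u v in e
      ...   | false = refl
      ...   | true  = ⊥-elim (<⇒≱ i<φ (reach⇒φ≤ i u e))
      unreachable i | no i≮φ rewrite ¬T⇒≡false (λ t → i≮φ (<ᵇ⇒< i (φ u) t)) =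
        cong not (subst (λ z → reach G z u v ≡ true) (m∸n+n≡m (≮⇒≥ i≮φ))
          (reach-mono (i ∸ φ u) (φ u) u v (φ≡⇒reach (φ u) u refl)))

-- The cycle C_k

n<m⇒m∸n≡1+[m∸1+n] : ∀ m n → n < m → m ∸ n ≡ suc (m ∸ suc n)
n<m⇒m∸n≡1+[m∸1+n] (suc m) zero    _         = refl
n<m⇒m∸n≡1+[m∸1+n] (suc m) (suc n) (s≤s n<m) = n<m⇒m∸n≡1+[m∸1+n] m n n<m

m∸n≤1+[m∸1+n] : ∀ m n → m ∸ n ≤ suc (m ∸ suc n)
m∸n≤1+[m∸1+n] zero    n       = subst (_≤ 1) (sym (0∸n≡0 n)) z≤n
m∸n≤1+[m∸1+n] (suc m) zero    = ≤-refl
m∸n≤1+[m∸1+n] (suc m) (suc n) = m∸n≤1+[m∸1+n] m n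

module Cycle (k : ℕ) (2≤k : 2 ≤ k) where

  next : ℕ → ℕ
  next x = if suc x <ᵇ k then suc x else 0

  prev : ℕ → ℕ
  prev x = if x ≡ᵇ 0 then k ∸ 1 else x ∸ 1

  forward : ℕ → ℕ → ℕ
  forward x y = if x ≤ᵇ y then y ∸ x else (k ∸ x) + y

  cycDist : ℕ → ℕ → ℕ
  cycDist x y = forward x y ⊓ (k ∸ forward x y)

  1+[k∸1]≡k : suc (k ∸ 1) ≡ k
  1+[k∸1]≡k = trans (+-comm 1 (k ∸ 1)) (m∸n+n≡m (≤-trans (s≤s z≤n) 2≤k))

  next-suc : ∀ x → suc x < k → next x ≡ suc x
  next-suc x lt rewrite <ᵇ-true lt = refl

  next-last : ∀ x → suc x ≡ k → next x ≡ 0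
  next-last x e rewrite <ᵇ-false {suc x} {k} (≤-reflexive (sym e)) = refl

  next<k : ∀ x → x < k → next x < k
  next<k x x<k with suc x <? k
  ... | yes lt = subst (_< k) (sym (next-suc x lt)) lt
  ... | no ¬lt = subst (_< k) (sym (next-last x (≤-antisym x<k (≮⇒≥ ¬lt)))) (≤-trans (s≤s z≤n) 2≤k)

  prev<k : ∀ x → x < k → prev x < k
  prev<k zero    _   = ≤-reflexive 1+[k∸1]≡k
  prev<k (suc x) x<k = <-trans (n<1+n x) x<k

  next-prev : ∀ x → x < k → next (prev x) ≡ x
  next-prev zero    _   = next-last (k ∸ 1) 1+[k∸1]≡k
  next-prev (suc x) x<k = next-suc x x<k

  forward-≤ : ∀ x y → x ≤ y → forward x y ≡ y ∸ x
  forward-≤ x y le rewrite ≤ᵇ-true le = refl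

  forward-> : ∀ x y → y < x → forward x y ≡ (k ∸ x) + y
  forward-> x y lt rewrite ≤ᵇ-false lt = refl

  forward<k : ∀ x y → x < k → y < k → forward x y < k
  forward<k x y x<k y<k with x ≤? y
  ... | yes x≤y rewrite forward-≤ x y x≤y = ≤-<-trans (m∸n≤m y x) y<k
  ... | no  x≰y rewrite forward-> x y (≰⇒> x≰y) = begin
      suc (k ∸ x + y)  ≡⟨ sym (+-suc (k ∸ x) y) ⟩
      k ∸ x + suc y    ≤⟨ +-monoʳ-≤ (k ∸ x) (≰⇒> x≰y) ⟩
      k ∸ x + x        ≡⟨ m∸n+n≡m (<⇒≤ x<k) ⟩
      k                ∎
    where open ≤-Reasoning

  forward≡0⇒≡ : ∀ x y → x < k → forward x y ≡ 0 → x ≡ y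
  forward≡0⇒≡ x y x<k e with x ≤? y
  ... | yes x≤y rewrite forward-≤ x y x≤y = ≤-antisym x≤y (m∸n≡0⇒m≤n e)
  ... | no  x≰y rewrite forward-> x y (≰⇒> x≰y) | n<m⇒m∸n≡1+[m∸1+n] k x x<k with e
  ...   | ()

  forward-refl : ∀ x → forward x x ≡ 0
  forward-refl x = trans (forward-≤ x x ≤-refl) (n∸n≡0 x)

  forward-next : ∀ x y j → x < k → y < k → forward x y ≡ suc j → forward (next x) y ≡ j
  forward-next x y j x<k y<k e with x ≤? y
  ... | yes x≤y rewrite forward-≤ x y x≤y with suc x ≤? y
  ...   | yes sx≤y rewrite next-suc x (≤-<-trans sx≤y y<k) | forward-≤ (suc x) y sx≤y =
          trans (sym (pred[m∸n]≡m∸[1+n] y x)) (cong pred e)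
  ...   | no  sx≰y with ≤-antisym x≤y (≤-pred (≰⇒> sx≰y))
  ...     | refl with trans (sym (n∸n≡0 x)) e
  ...       | ()
  forward-next x y j x<k y<k e | no x≰y rewrite forward-> x y (≰⇒> x≰y) with suc x <? k
  ... | yes sx<k rewrite next-suc x sx<k | forward-> (suc x) y (≤-trans (≰⇒> x≰y) (n≤1+n x))
                       | n<m⇒m∸n≡1+[m∸1+n] k x x<k = suc-injective e
  ... | no  sx≮k rewrite next-last x (≤-antisym x<k (≮⇒≥ sx≮k)) | forward-≤ 0 y z≤n
                       | sym (≤-antisym x<k (≮⇒≥ sx≮k)) | n<m⇒m∸n≡1+[m∸1+n] (suc x) x ≤-refl
                       | n∸n≡0 x = suc-injective e

  forward-next-self : ∀ x → x < k → forward (next x) x ≡ k ∸ 1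
  forward-next-self x x<k with suc x <? k
  ... | yes sx<k rewrite next-suc x sx<k | forward-> (suc x) x ≤-refl =
        trans (cong (_+ x) (sym (∸-+-assoc k 1 x)))
              (m∸n+n≡m {k ∸ 1} {x} (m+n≤o⇒m≤o∸n x (subst (_≤ k) (+-comm 1 x) (<⇒≤ sx<k))))
  ... | no  sx≮k rewrite next-last x (≤-antisym x<k (≮⇒≥ sx≮k)) | forward-≤ 0 x z≤n
                       | sym (≤-antisym x<k (≮⇒≥ sx≮k)) = refl

  cycDist-refl : ∀ x → cycDist x x ≡ 0
  cycDist-refl x rewrite forward-refl x = refl

  cycDist≡0⇒≡ : ∀ x y → x < k → y < k → cycDist x y ≡ 0 → x ≡ y
  cycDist≡0⇒≡ x y x<k y<k e with forward x y in ef
  ... | zero  = forward≡0⇒≡ x y x<k ef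
  ... | suc j with k ∸ suc j in ek
  ...   | zero = ⊥-elim (<⇒≱ (subst (_< k) ef (forward<k x y x<k y<k)) (m∸n≡0⇒m≤n ek))

  cycDist≤k∸1 : ∀ x y → x < k → y < k → cycDist x y ≤ k ∸ 1
  cycDist≤k∸1 x y x<k y<k = ≤-trans (m⊓n≤m (forward x y) _)
    (m+n≤o⇒m≤o∸n (forward x y) (subst (_≤ k) (+-comm 1 (forward x y)) (forward<k x y x<k y<k)))

  cycDist≤1+cycDist-next : ∀ x y → x < k → y < k → cycDist x y ≤ suc (cycDist (next x) y)
  cycDist≤1+cycDist-next x y x<k y<k with forward x y in e
  ... | zero  = z≤n
  ... | suc j rewrite forward-next x y j x<k y<k e =
        ⊓-mono-≤ ≤-refl (≤-trans (∸-monoʳ-≤ k (n≤1+n j)) (n≤1+n _))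

  cycDist-next≤1+cycDist : ∀ x y → x < k → y < k → cycDist (next x) y ≤ suc (cycDist x y)
  cycDist-next≤1+cycDist x y x<k y<k with forward x y in e
  ... | zero rewrite forward≡0⇒≡ x y x<k e | forward-next-self y y<k =
        ≤-trans (m⊓n≤n (k ∸ 1) (k ∸ (k ∸ 1))) (≤-reflexive (m∸[m∸n]≡n (≤-trans (s≤s z≤n) 2≤k)))
  ... | suc j rewrite forward-next x y j x<k y<k e =
        ⊓-mono-≤ (≤-trans (n≤1+n j) (n≤1+n _)) (m∸n≤1+[m∸1+n] k j)

  -- Going one step forward shortens the forward route; if the backward route is the shorter
  -- one, going one step back shortens that instead.
  cycDist-descent : ∀ x y j → x < k → y < k → cycDist x y ≡ suc j →
                    cycDist (next x) y ≡ j ⊎ cycDist (prev x) y ≡ j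
  cycDist-descent x y j x<k y<k e with forward x y in ef
  ... | suc i with suc i ≤? k ∸ suc i
  ...   | yes fwd rewrite m≤n⇒m⊓n≡m fwd | forward-next x y i x<k y<k ef =
          inj₁ (trans (m≤n⇒m⊓n≡m (≤-trans (n≤1+n i) (≤-trans fwd (∸-monoʳ-≤ k (n≤1+n i))))) (suc-injective e))
  ...   | no  bwd = inj₂ (via-prev (forward (prev x) y) refl)
    where
    z = prev x
    z<k = prev<k x x<k
    k∸1+i≡1+j : k ∸ suc i ≡ suc j
    k∸1+i≡1+j = trans (sym (m≥n⇒m⊓n≡n (<⇒≤ (≰⇒> bwd)))) e
    via-prev : ∀ f → forward z y ≡ f → cycDist z y ≡ j
    via-prev zero ez with forward≡0⇒≡ z y z<k ez
    ... | refl = trans (cycDist-refl z)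
                   (sym (suc-injective (trans (sym k∸1+i≡1+j)
                     (trans (cong (k ∸_) 1+i≡k∸1) (m∸[m∸n]≡n {k} {1} (≤-trans (s≤s z≤n) 2≤k))))))
      where
      1+i≡k∸1 : suc i ≡ k ∸ 1
      1+i≡k∸1 = trans (sym ef) (subst (λ w → forward w z ≡ k ∸ 1) (next-prev x x<k) (forward-next-self z z<k))
    via-prev (suc i′) ez with trans (sym (subst (λ w → forward w y ≡ i′) (next-prev x x<k)
                                             (forward-next z y i′ z<k y<k ez))) ef
    ... | refl rewrite ez = trans (m≥n⇒m⊓n≡n (≤-trans (≤-reflexive k∸2+i≡j) (≤-trans (<⇒≤ j<1+i) (n≤1+n _)))) k∸2+i≡j
      where
      k∸2+i≡j : k ∸ suc (suc i) ≡ j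
      k∸2+i≡j = trans (sym (pred[m∸n]≡m∸[1+n] k (suc i))) (cong pred k∸1+i≡1+j)
      j<1+i : j < suc i
      j<1+i = ≤-trans (n≤1+n (suc j)) (subst (λ w → suc w ≤ suc i) k∸1+i≡1+j (≰⇒> bwd))

-- Distances and eccentricities in H^t(n,k;m,0,…,0)

data Kind : Set where
  onCycle hub pendant leaf : Kind

depth : Kind → ℕ
depth onCycle = 0
depth hub = 1
depth pendant = 1
depth leaf = 2

module HGraph (k m t : ℕ) (3≤k : 3 ≤ k) (1≤m : 1 ≤ m) (1≤t : 1 ≤ t) where
  2≤k : 2 ≤ k
  2≤k = ≤-trans (n≤1+n 2) 3≤k
  open Cycle k 2≤k public

  n : ℕ
  n = k + m + t

  adjH : ℕ → ℕ → Bool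
  adjH a b = Hedge k m t a b ∨ Hedge k m t b a

  kind : ℕ → Kind
  kind x = if x <ᵇ k then onCycle else (if x ≡ᵇ k then hub else (if x <ᵇ k + m then pendant else leaf))

  -- Every path from a vertex off the cycle to the cycle passes through v₁ = 0, and depth is the
  -- distance to v₁; two pendant vertices, or two leaves, are joined through v₁, resp. the hub.
  hdistBy : Kind → Kind → ℕ → ℕ → ℕ
  hdistBy onCycle onCycle x y = cycDist x y
  hdistBy onCycle c       x y = cycDist x 0 + depth c
  hdistBy c       onCycle x y = depth c + cycDist 0 y
  hdistBy hub     hub     x y = 0
  hdistBy hub     pendant x y = 2
  hdistBy hub     leaf    x y = 1
  hdistBy pendant hub     x y = 2
  hdistBy pendant pendant x y = if x ≡ᵇ y then 0 else 2
  hdistBy pendant leaf    x y = 3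
  hdistBy leaf    hub     x y = 1
  hdistBy leaf    pendant x y = 3
  hdistBy leaf    leaf    x y = if x ≡ᵇ y then 0 else 2

  hdist : ℕ → ℕ → ℕ
  hdist x y = hdistBy (kind x) (kind y) x y

  data Position : ℕ → Set where
    onCycle : ∀ x → x < k → Position x
    hub     : Position k
    pendant : ∀ x → k < x → x < k + m → Position x
    leaf    : ∀ x → k + m ≤ x → Position x

  position : ∀ x → Position x
  position x with x <? k
  ... | yes x<k = onCycle x x<k
  ... | no  x≮k with x ≟ℕ k
  ...   | yes refl = hub
  ...   | no  x≢k with x <? k + m
  ...     | yes x<k+m = pendant x (≤∧≢⇒< (≮⇒≥ x≮k) (λ e → x≢k (sym e))) x<k+m
  ...     | no  x≮k+m = leaf x (≮⇒≥ x≮k+m)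

  kind-onCycle : ∀ x → x < k → kind x ≡ onCycle
  kind-onCycle x x<k rewrite <ᵇ-true x<k = refl

  kind-hub : kind k ≡ hub
  kind-hub rewrite <ᵇ-false {k} {k} ≤-refl | ≡ᵇ-true {k} {k} refl = refl

  kind-pendant : ∀ x → k < x → x < k + m → kind x ≡ pendant
  kind-pendant x k<x x<k+m rewrite <ᵇ-false (<⇒≤ k<x) | ≡ᵇ-false {x} {k} (λ e → <-irrefl (sym e) k<x) | <ᵇ-true x<k+m = refl

  kind-leaf : ∀ x → k + m ≤ x → kind x ≡ leaf
  kind-leaf x k+m≤x rewrite <ᵇ-false {x} {k} (≤-trans (m≤m+n k m) k+m≤x)
                          | ≡ᵇ-false {x} {k} (λ e → <-irrefl refl (<-≤-trans (m<m+n k 1≤m) (subst (k + m ≤_) e k+m≤x)))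
                          | <ᵇ-false k+m≤x = refl

  data Edge : ℕ → ℕ → Set where
    cyc⁺  : ∀ x → x < k → Edge x (next x)
    cyc⁻  : ∀ x → x < k → Edge (next x) x
    pend⁺ : ∀ y → k ≤ y → y < k + m → Edge 0 y
    pend⁻ : ∀ y → k ≤ y → y < k + m → Edge y 0
    leaf⁺ : ∀ y → k + m ≤ y → y < n → Edge k y
    leaf⁻ : ∀ y → k + m ≤ y → y < n → Edge y k

  Edge-sym : ∀ {a b} → Edge a b → Edge b a
  Edge-sym (cyc⁺ x x<k)         = cyc⁻ x x<k
  Edge-sym (cyc⁻ x x<k)         = cyc⁺ x x<k
  Edge-sym (pend⁺ y k≤y y<k+m)  = pend⁻ y k≤y y<k+m
  Edge-sym (pend⁻ y k≤y y<k+m)  = pend⁺ y k≤y y<k+m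
  Edge-sym (leaf⁺ y k+m≤y y<n)  = leaf⁻ y k+m≤y y<n
  Edge-sym (leaf⁻ y k+m≤y y<n)  = leaf⁺ y k+m≤y y<n

  private
    cycleClause pendantClause leafClause : ℕ → ℕ → Bool
    cycleClause   a b = (b <ᵇ k) ∧ ((b ≡ᵇ suc a) ∨ ((a ≡ᵇ 0) ∧ (b ≡ᵇ (k ∸ 1)))) ∧ (a <ᵇ b)
    pendantClause a b = (a ≡ᵇ 0) ∧ (k ≤ᵇ b) ∧ (b <ᵇ k + m)
    leafClause    a b = (a ≡ᵇ k) ∧ (k + m ≤ᵇ b) ∧ (b <ᵇ k + m + t)

    cycleClause⇒Edge : ∀ a b → cycleClause a b ≡ true → Edge a b
    cycleClause⇒Edge a b e with ∧-true⁻ (b <ᵇ k) e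
    ... | b<k , e′ with ∧-true⁻ _ e′
    ...   | step-or-wrap , _ with ∨-true⁻ (b ≡ᵇ suc a) step-or-wrap
    ...     | inj₁ b≡1+a with ≡ᵇ-true⁻ {b} {suc a} b≡1+a
    ...       | refl = subst (Edge a) (next-suc a (<ᵇ-true⁻ b<k)) (cyc⁺ a (<-trans (n<1+n a) (<ᵇ-true⁻ b<k)))
    cycleClause⇒Edge a b e | b<k , _ | _ , _ | inj₂ wrap with ∧-true⁻ (a ≡ᵇ 0) wrap
    ... | a≡0 , b≡k∸1 with ≡ᵇ-true⁻ {a} {0} a≡0 | ≡ᵇ-true⁻ {b} {k ∸ 1} b≡k∸1
    ...   | refl | refl = subst (λ z → Edge z (k ∸ 1)) (next-last (k ∸ 1) 1+[k∸1]≡k) (cyc⁻ (k ∸ 1) (<ᵇ-true⁻ b<k))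

    pendantClause⇒Edge : ∀ a b → pendantClause a b ≡ true → Edge a b
    pendantClause⇒Edge a b e with ∧-true⁻ (a ≡ᵇ 0) e
    ... | a≡0 , e′ with ∧-true⁻ (k ≤ᵇ b) e′ | ≡ᵇ-true⁻ {a} {0} a≡0
    ...   | k≤b , b<k+m | refl = pend⁺ b (≤ᵇ-true⁻ k≤b) (<ᵇ-true⁻ b<k+m)

    leafClause⇒Edge : ∀ a b → leafClause a b ≡ true → Edge a b
    leafClause⇒Edge a b e with ∧-true⁻ (a ≡ᵇ k) e
    ... | a≡k , e′ with ∧-true⁻ (k + m ≤ᵇ b) e′ | ≡ᵇ-true⁻ {a} {k} a≡k
    ...   | k+m≤b , b<n | refl = leaf⁺ b (≤ᵇ-true⁻ k+m≤b) (<ᵇ-true⁻ b<n)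

    ∧₃-true⁺ : ∀ {a b c} → a ≡ true → b ≡ true → c ≡ true → a ∧ b ∧ c ≡ true
    ∧₃-true⁺ refl refl refl = refl

    cycleClause-step : ∀ x → suc x < k → cycleClause x (suc x) ≡ true
    cycleClause-step x 1+x<k = ∧₃-true⁺ (<ᵇ-true 1+x<k) (∨-trueˡ _ (≡ᵇ-true {suc x} refl)) (<ᵇ-true (n<1+n x))

    cycleClause-wrap : cycleClause 0 (k ∸ 1) ≡ true
    cycleClause-wrap = ∧₃-true⁺ (<ᵇ-true (≤-reflexive 1+[k∸1]≡k)) (∨-trueʳ (k ∸ 1 ≡ᵇ 1) (≡ᵇ-true {k ∸ 1} refl))
                                (<ᵇ-true (≤-trans (s≤s z≤n) (≤-pred (subst (3 ≤_) (sym 1+[k∸1]≡k) 3≤k))))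

    Hedge-cycle : ∀ a b → cycleClause a b ≡ true → Hedge k m t a b ≡ true
    Hedge-cycle a b e = ∨-trueˡ (pendantClause a b ∨ leafClause a b) e
    Hedge-pendant : ∀ a b → pendantClause a b ≡ true → Hedge k m t a b ≡ true
    Hedge-pendant a b e = ∨-trueʳ (cycleClause a b) (∨-trueˡ (leafClause a b) e)
    Hedge-leaf : ∀ a b → leafClause a b ≡ true → Hedge k m t a b ≡ true
    Hedge-leaf a b e = ∨-trueʳ (cycleClause a b) (∨-trueʳ (pendantClause a b) e)

    adjH-forward : ∀ a b → Hedge k m t a b ≡ true → adjH a b ≡ true
    adjH-forward a b e = ∨-trueˡ (Hedge k m t b a) e
    adjH-backward : ∀ a b → Hedge k m t b a ≡ true → adjH a b ≡ true
    adjH-backward a b e = ∨-trueʳ (Hedge k m t a b) e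


  Hedge⇒Edge : ∀ a b → Hedge k m t a b ≡ true → Edge a b
  Hedge⇒Edge a b e with ∨-true⁻ (cycleClause a b) e
  ... | inj₁ c = cycleClause⇒Edge a b c
  ... | inj₂ e′ with ∨-true⁻ (pendantClause a b) e′
  ...   | inj₁ p = pendantClause⇒Edge a b p
  ...   | inj₂ l = leafClause⇒Edge a b l

  adj⇒Edge : ∀ a b → adjH a b ≡ true → Edge a b
  adj⇒Edge a b e with ∨-true⁻ (Hedge k m t a b) e
  ... | inj₁ ab = Hedge⇒Edge a b ab
  ... | inj₂ ba = Edge-sym (Hedge⇒Edge b a ba)

  Edge⇒adj : ∀ a b → Edge a b → adjH a b ≡ true
  Edge⇒adj a b (cyc⁺ x x<k) with suc x <? k
  ... | yes 1+x<k rewrite next-suc x 1+x<k = adjH-forward x (suc x) (Hedge-cycle x (suc x) (cycleClause-step x 1+x<k))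
  ... | no  1+x≮k with ≤-antisym x<k (≮⇒≥ 1+x≮k)
  ...   | refl rewrite next-last x refl = adjH-backward x 0 (Hedge-cycle 0 x cycleClause-wrap)
  Edge⇒adj a b (cyc⁻ x x<k) with suc x <? k
  ... | yes 1+x<k rewrite next-suc x 1+x<k = adjH-backward (suc x) x (Hedge-cycle x (suc x) (cycleClause-step x 1+x<k))
  ... | no  1+x≮k with ≤-antisym x<k (≮⇒≥ 1+x≮k)
  ...   | refl rewrite next-last x refl = adjH-forward 0 x (Hedge-cycle 0 x cycleClause-wrap)
  Edge⇒adj a b (pend⁺ y k≤y y<k+m) = adjH-forward 0 y (Hedge-pendant 0 y (∧₃-true⁺ refl (≤ᵇ-true k≤y) (<ᵇ-true y<k+m)))
  Edge⇒adj a b (pend⁻ y k≤y y<k+m) = adjH-backward y 0 (Hedge-pendant 0 y (∧₃-true⁺ refl (≤ᵇ-true k≤y) (<ᵇ-true y<k+m)))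
  Edge⇒adj a b (leaf⁺ y k+m≤y y<n) = adjH-forward k y (Hedge-leaf k y (∧₃-true⁺ (≡ᵇ-true {k} refl) (≤ᵇ-true k+m≤y) (<ᵇ-true y<n)))
  Edge⇒adj a b (leaf⁻ y k+m≤y y<n) = adjH-backward y k (Hedge-leaf k y (∧₃-true⁺ (≡ᵇ-true {k} refl) (≤ᵇ-true k+m≤y) (<ᵇ-true y<n)))

  hdist-cycle-cycle : ∀ x y → x < k → y < k → hdist x y ≡ cycDist x y
  hdist-cycle-cycle x y x<k y<k rewrite kind-onCycle x x<k | kind-onCycle y y<k = refl

  hdist-cycle-off : ∀ x y → x < k → k ≤ y → hdist x y ≡ cycDist x 0 + depth (kind y)
  hdist-cycle-off x y x<k k≤y rewrite kind-onCycle x x<k with position y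
  ... | onCycle .y y<k = ⊥-elim (<⇒≱ y<k k≤y)
  ... | hub rewrite kind-hub = refl
  ... | pendant .y k<y y<k+m rewrite kind-pendant y k<y y<k+m = refl
  ... | leaf .y k+m≤y rewrite kind-leaf y k+m≤y = refl

  hdist-off-cycle : ∀ x y → k ≤ x → y < k → hdist x y ≡ depth (kind x) + cycDist 0 y
  hdist-off-cycle x y k≤x y<k rewrite kind-onCycle y y<k with position x
  ... | onCycle .x x<k = ⊥-elim (<⇒≱ x<k k≤x)
  ... | hub rewrite kind-hub = refl
  ... | pendant .x k<x x<k+m rewrite kind-pendant x k<x x<k+m = refl
  ... | leaf .x k+m≤x rewrite kind-leaf x k+m≤x = refl

  depth-off : ∀ y → k ≤ y → (1 ≤ depth (kind y)) × (depth (kind y) ≤ 2)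
  depth-off y k≤y with position y
  ... | onCycle .y y<k = ⊥-elim (<⇒≱ y<k k≤y)
  ... | hub rewrite kind-hub = s≤s z≤n , s≤s z≤n
  ... | pendant .y k<y y<k+m rewrite kind-pendant y k<y y<k+m = s≤s z≤n , s≤s z≤n
  ... | leaf .y k+m≤y rewrite kind-leaf y k+m≤y = s≤s z≤n , ≤-refl

  0<k : 0 < k
  0<k = ≤-trans (s≤s z≤n) 3≤k
  k<k+m : k < k + m
  k<k+m = m<m+n k 1≤m
  k+m<n : k + m < n
  k+m<n = m<m+n (k + m) 1≤t

  hdist-refl : ∀ x → hdist x x ≡ 0
  hdist-refl x with position x
  ... | onCycle .x x<k rewrite kind-onCycle x x<k = cycDist-refl x
  ... | hub rewrite kind-hub = refl
  ... | pendant .x k<x x<k+m rewrite kind-pendant x k<x x<k+m | ≡ᵇ-refl x = refl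
  ... | leaf .x k+m≤x rewrite kind-leaf x k+m≤x | ≡ᵇ-refl x = refl

  hdist≡0⇒≡ : ∀ x y → x < n → y < n → hdist x y ≡ 0 → x ≡ y
  hdist≡0⇒≡ x y x<n y<n e with x <? k | y <? k
  ... | yes x<k | yes y<k = cycDist≡0⇒≡ x y x<k y<k (trans (sym (hdist-cycle-cycle x y x<k y<k)) e)
  ... | yes x<k | no y≮k = ⊥-elim (<⇒≱ (proj₁ (depth-off y (≮⇒≥ y≮k))) (≤-reflexive (m+n≡0⇒n≡0 (cycDist x 0) (trans (sym (hdist-cycle-off x y x<k (≮⇒≥ y≮k))) e))))
  ... | no x≮k | yes y<k = ⊥-elim (<⇒≱ (proj₁ (depth-off x (≮⇒≥ x≮k))) (≤-reflexive (m+n≡0⇒m≡0 (depth (kind x)) (trans (sym (hdist-off-cycle x y (≮⇒≥ x≮k) y<k)) e))))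
  ... | no x≮k | no y≮k with position x | position y
  ... | onCycle .x x<k | _ = ⊥-elim (x≮k x<k)
  ... | _ | onCycle .y y<k = ⊥-elim (y≮k y<k)
  ... | hub | hub = refl
  ... | hub | pendant .y k<y y<k+m rewrite kind-hub | kind-pendant y k<y y<k+m = case e of λ ()
  ... | hub | leaf .y k+m≤y rewrite kind-hub | kind-leaf y k+m≤y = case e of λ ()
  ... | pendant .x k<x x<k+m | hub rewrite kind-hub | kind-pendant x k<x x<k+m = case e of λ ()
  ... | pendant .x k<x x<k+m | pendant .y k<y y<k+m rewrite kind-pendant x k<x x<k+m | kind-pendant y k<y y<k+m with x ≡ᵇ y in ee
  ...   | true = ≡ᵇ-true⁻ ee
  ...   | false = case e of λ ()
  hdist≡0⇒≡ x y x<n y<n e | no x≮k | no y≮k | pendant .x k<x x<k+m | leaf .y k+m≤y rewrite kind-pendant x k<x x<k+m | kind-leaf y k+m≤y = case e of λ ()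
  hdist≡0⇒≡ x y x<n y<n e | no x≮k | no y≮k | leaf .x k+m≤x | hub rewrite kind-hub | kind-leaf x k+m≤x = case e of λ ()
  hdist≡0⇒≡ x y x<n y<n e | no x≮k | no y≮k | leaf .x k+m≤x | pendant .y k<y y<k+m rewrite kind-leaf x k+m≤x | kind-pendant y k<y y<k+m = case e of λ ()
  hdist≡0⇒≡ x y x<n y<n e | no x≮k | no y≮k | leaf .x k+m≤x | leaf .y k+m≤y rewrite kind-leaf x k+m≤x | kind-leaf y k+m≤y with x ≡ᵇ y in ee
  ...   | true = ≡ᵇ-true⁻ ee
  ...   | false = case e of λ ()

  depth-hub-pendant : ∀ y → k ≤ y → y < k + m → depth (kind y) ≡ 1
  depth-hub-pendant y l1 l2 with position y
  ... | onCycle .y y<k = ⊥-elim (<⇒≱ y<k l1)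
  ... | hub rewrite kind-hub = refl
  ... | pendant .y k<y _ rewrite kind-pendant y k<y l2 = refl
  ... | leaf .y k+m≤y = ⊥-elim (<⇒≱ l2 k+m≤y)

  depth-leaf : ∀ y → k + m ≤ y → depth (kind y) ≡ 2
  depth-leaf y l rewrite kind-leaf y l = refl

  hdist-off≤depth+depth : ∀ x y → k ≤ x → k ≤ y → hdist x y ≤ depth (kind x) + depth (kind y)
  hdist-off≤depth+depth x y k≤x k≤y with position x | position y
  ... | onCycle .x x<k | _ = ⊥-elim (<⇒≱ x<k k≤x)
  ... | _ | onCycle .y y<k = ⊥-elim (<⇒≱ y<k k≤y)
  ... | hub | hub rewrite kind-hub = z≤n
  ... | hub | pendant .y k<y y<k+m rewrite kind-hub | kind-pendant y k<y y<k+m = ≤-refl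
  ... | hub | leaf .y k+m≤y rewrite kind-hub | kind-leaf y k+m≤y = s≤s z≤n
  ... | pendant .x k<x x<k+m | hub rewrite kind-hub | kind-pendant x k<x x<k+m = ≤-refl
  ... | pendant .x k<x x<k+m | pendant .y k<y y<k+m rewrite kind-pendant x k<x x<k+m | kind-pendant y k<y y<k+m with x ≡ᵇ y
  ...   | true = z≤n
  ...   | false = ≤-refl
  hdist-off≤depth+depth x y k≤x k≤y | pendant .x k<x x<k+m | leaf .y k+m≤y rewrite kind-pendant x k<x x<k+m | kind-leaf y k+m≤y = ≤-refl
  hdist-off≤depth+depth x y k≤x k≤y | leaf .x k+m≤x | hub rewrite kind-hub | kind-leaf x k+m≤x = s≤s z≤n
  hdist-off≤depth+depth x y k≤x k≤y | leaf .x k+m≤x | pendant .y k<y y<k+m rewrite kind-leaf x k+m≤x | kind-pendant y k<y y<k+m = ≤-refl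
  hdist-off≤depth+depth x y k≤x k≤y | leaf .x k+m≤x | leaf .y k+m≤y rewrite kind-leaf x k+m≤x | kind-leaf y k+m≤y with x ≡ᵇ y
  ...   | true = z≤n
  ...   | false = s≤s (s≤s z≤n)

  4≤n : 4 ≤ n
  4≤n = ≤-trans (+-mono-≤ 3≤k 1≤m) (m≤m+n (k + m) t)

  hdist≤n : ∀ x y → x < n → y < n → hdist x y ≤ n
  hdist≤n x y x<n y<n with x <? k | y <? k
  ... | yes x<k | yes y<k rewrite hdist-cycle-cycle x y x<k y<k = ≤-trans (cycDist≤k∸1 x y x<k y<k) (≤-trans (m∸n≤m k 1) (≤-trans (m≤m+n k m) (m≤m+n (k + m) t)))
  ... | yes x<k | no y≮k rewrite hdist-cycle-off x y x<k (≮⇒≥ y≮k) = ≤-trans (+-mono-≤ (cycDist≤k∸1 x 0 x<k 0<k) (proj₂ (depth-off y (≮⇒≥ y≮k)))) bnd2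
    where
    bnd2 : k ∸ 1 + 2 ≤ n
    bnd2 = subst (_≤ n) (sym (trans (+-comm (k ∸ 1) 2) (cong suc 1+[k∸1]≡k))) (≤-trans k<k+m (m≤m+n (k + m) t))
  ... | no x≮k | yes y<k rewrite hdist-off-cycle x y (≮⇒≥ x≮k) y<k = ≤-trans (+-mono-≤ (proj₂ (depth-off x (≮⇒≥ x≮k))) (cycDist≤k∸1 0 y 0<k y<k)) bnd2
    where
    bnd2 : 2 + (k ∸ 1) ≤ n
    bnd2 = subst (_≤ n) (sym (cong suc 1+[k∸1]≡k)) (≤-trans k<k+m (m≤m+n (k + m) t))
  ... | no x≮k | no y≮k = ≤-trans (hdist-off≤depth+depth x y (≮⇒≥ x≮k) (≮⇒≥ y≮k))
                          (≤-trans (+-mono-≤ (proj₂ (depth-off x (≮⇒≥ x≮k))) (proj₂ (depth-off y (≮⇒≥ y≮k)))) 4≤n)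

  hdist-hub≤2 : ∀ y → k ≤ y → hdist k y ≤ 2
  hdist-hub≤2 y k≤y with position y
  ... | onCycle .y y<k = ⊥-elim (<⇒≱ y<k k≤y)
  ... | hub rewrite kind-hub = z≤n
  ... | pendant .y k<y y<k+m rewrite kind-hub | kind-pendant y k<y y<k+m = ≤-refl
  ... | leaf .y k+m≤y rewrite kind-hub | kind-leaf y k+m≤y = s≤s z≤n

  hdist-pos : ∀ x y → x < n → y < n → x ≢ y → 1 ≤ hdist x y
  hdist-pos x y x<n y<n ne with hdist x y in e
  ... | zero = ⊥-elim (ne (hdist≡0⇒≡ x y x<n y<n e))
  ... | suc _ = s≤s z≤n

  m≤1+[n+m] : ∀ n m → m ≤ suc (n + m)
  m≤1+[n+m] n m = ≤-trans (m≤n+m m n) (n≤1+n _)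

  hdist-edge : ∀ x z y → y < n → Edge x z → hdist x y ≤ suc (hdist z y)
  hdist-edge _ _ y y<n (cyc⁺ c c<k) with y <? k
  ... | yes y<k rewrite hdist-cycle-cycle c y c<k y<k | hdist-cycle-cycle (next c) y (next<k c c<k) y<k =
        cycDist≤1+cycDist-next c y c<k y<k
  ... | no  y≮k rewrite hdist-cycle-off c y c<k (≮⇒≥ y≮k) | hdist-cycle-off (next c) y (next<k c c<k) (≮⇒≥ y≮k) =
        +-monoˡ-≤ (depth (kind y)) (cycDist≤1+cycDist-next c 0 c<k 0<k)
  hdist-edge _ _ y y<n (cyc⁻ c c<k) with y <? k
  ... | yes y<k rewrite hdist-cycle-cycle c y c<k y<k | hdist-cycle-cycle (next c) y (next<k c c<k) y<k =
        cycDist-next≤1+cycDist c y c<k y<k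
  ... | no  y≮k rewrite hdist-cycle-off c y c<k (≮⇒≥ y≮k) | hdist-cycle-off (next c) y (next<k c c<k) (≮⇒≥ y≮k) =
        +-monoˡ-≤ (depth (kind y)) (cycDist-next≤1+cycDist c 0 c<k 0<k)
  hdist-edge _ _ y y<n (pend⁺ p k≤p p<k+m) with y <? k
  ... | yes y<k rewrite hdist-cycle-cycle 0 y 0<k y<k | hdist-off-cycle p y k≤p y<k = m≤1+[n+m] (depth (kind p)) (cycDist 0 y)
  ... | no  y≮k rewrite hdist-cycle-off 0 y 0<k (≮⇒≥ y≮k) with p ≟ℕ y
  ...   | yes refl rewrite depth-hub-pendant p k≤p p<k+m | hdist-refl p = ≤-refl
  ...   | no  p≢y = ≤-trans (proj₂ (depth-off y (≮⇒≥ y≮k))) (s≤s (hdist-pos p y (<-trans p<k+m k+m<n) y<n p≢y))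
  hdist-edge _ _ y y<n (pend⁻ p k≤p p<k+m) with y <? k
  ... | yes y<k rewrite hdist-cycle-cycle 0 y 0<k y<k | hdist-off-cycle p y k≤p y<k | depth-hub-pendant p k≤p p<k+m = ≤-refl
  ... | no  y≮k rewrite hdist-cycle-off 0 y 0<k (≮⇒≥ y≮k) =
        ≤-trans (hdist-off≤depth+depth p y k≤p (≮⇒≥ y≮k)) (≤-reflexive (cong (_+ depth (kind y)) (depth-hub-pendant p k≤p p<k+m)))
  hdist-edge _ _ y y<n (leaf⁺ q k+m≤q q<n) with y <? k
  ... | yes y<k rewrite hdist-off-cycle k y ≤-refl y<k | hdist-off-cycle q y (≤-trans (m≤m+n k m) k+m≤q) y<k
                      | kind-hub | kind-leaf q k+m≤q = ≤-trans (n≤1+n _) (n≤1+n _)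
  ... | no  y≮k with q ≟ℕ y
  ...   | yes refl rewrite hdist-refl q | kind-hub | kind-leaf q k+m≤q = ≤-refl
  ...   | no  q≢y = ≤-trans (hdist-hub≤2 y (≮⇒≥ y≮k)) (s≤s (hdist-pos q y q<n y<n q≢y))
  hdist-edge _ _ y y<n (leaf⁻ q k+m≤q q<n) with y <? k
  ... | yes y<k rewrite hdist-off-cycle k y ≤-refl y<k | hdist-off-cycle q y (≤-trans (m≤m+n k m) k+m≤q) y<k
                      | kind-hub | kind-leaf q k+m≤q = ≤-refl
  ... | no  y≮k with position y
  ...   | onCycle .y y<k = ⊥-elim (y≮k y<k)
  ...   | hub rewrite kind-hub | kind-leaf q k+m≤q = ≤-refl
  ...   | pendant .y k<y y<k+m rewrite kind-hub | kind-leaf q k+m≤q | kind-pendant y k<y y<k+m = ≤-refl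
  ...   | leaf .y k+m≤y rewrite kind-hub | kind-leaf q k+m≤q | kind-leaf y k+m≤y with q ≡ᵇ y
  ...     | true  = z≤n
  ...     | false = ≤-refl

  Descent : ℕ → ℕ → ℕ → Set
  Descent x y j = ∃[ z ] Edge x z × (z < n) × (hdist z y ≡ j)

  k<n : k < n
  k<n = <-trans k<k+m k+m<n
  <k⇒<n : ∀ {x} → x < k → x < n
  <k⇒<n l = <-trans l k<n

  hdist-0-off : ∀ y → k ≤ y → hdist 0 y ≡ depth (kind y)
  hdist-0-off y k≤y = hdist-cycle-off 0 y 0<k k≤y

  edge-prev : ∀ x → x < k → Edge x (prev x)
  edge-prev x x<k = subst (λ w → Edge w (prev x)) (next-prev x x<k) (cyc⁻ (prev x) (prev<k x x<k))

  descent-cycle-cycle : ∀ x y j → x < k → y < k → hdist x y ≡ suc j → Descent x y j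
  descent-cycle-cycle x y j x<k y<k e with cycDist-descent x y j x<k y<k (trans (sym (hdist-cycle-cycle x y x<k y<k)) e)
  ... | inj₁ e′ = next x , cyc⁺ x x<k , <k⇒<n (next<k x x<k) , trans (hdist-cycle-cycle _ y (next<k x x<k) y<k) e′
  ... | inj₂ e′ = prev x , edge-prev x x<k , <k⇒<n (prev<k x x<k) , trans (hdist-cycle-cycle _ y (prev<k x x<k) y<k) e′

  hdist-cycle-off-step : ∀ {x z y c j} → x < k → z < k → k ≤ y → cycDist x 0 ≡ suc c → cycDist z 0 ≡ c →
                         hdist x y ≡ suc j → hdist z y ≡ j
  hdist-cycle-off-step {x} {z} {y} x<k z<k k≤y ex ez e = begin
      hdist z y                     ≡⟨ hdist-cycle-off z y z<k k≤y ⟩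
      cycDist z 0 + depth (kind y)  ≡⟨ cong (_+ depth (kind y)) ez ⟩
      _                             ≡⟨ suc-injective (trans (cong (_+ depth (kind y)) (sym ex))
                                         (trans (sym (hdist-cycle-off x y x<k k≤y)) e)) ⟩
      _                             ∎
    where open ≡-Reasoning

  descent-cycle-off : ∀ x y j → x < k → k ≤ y → y < n → hdist x y ≡ suc j → Descent x y j
  descent-cycle-off x y j x<k k≤y y<n e with cycDist x 0 in ex
  ... | suc c with cycDist-descent x 0 c x<k 0<k ex
  ...   | inj₁ e′ = next x , cyc⁺ x x<k , <k⇒<n (next<k x x<k) , hdist-cycle-off-step x<k (next<k x x<k) k≤y ex e′ e
  ...   | inj₂ e′ = prev x , edge-prev x x<k , <k⇒<n (prev<k x x<k) , hdist-cycle-off-step x<k (prev<k x x<k) k≤y ex e′ e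
  descent-cycle-off x y j x<k k≤y y<n e | zero with cycDist≡0⇒≡ x 0 x<k 0<k ex
  ... | refl with y <? k + m
  ...   | yes y<k+m = y , pend⁺ y k≤y y<k+m , y<n
                    , trans (hdist-refl y) (suc-injective (trans (sym (depth-hub-pendant y k≤y y<k+m))
                                                                  (trans (sym (hdist-0-off y k≤y)) e)))
  ...   | no  y≮k+m = k , pend⁺ k ≤-refl k<k+m , k<n
                    , trans hub-to-leaf (suc-injective (trans (sym (depth-leaf y (≮⇒≥ y≮k+m)))
                                                               (trans (sym (hdist-0-off y k≤y)) e)))
    where
    hub-to-leaf : hdist k y ≡ 1
    hub-to-leaf rewrite kind-hub | kind-leaf y (≮⇒≥ y≮k+m) = refl

  descent-off-cycle : ∀ x y j → k ≤ x → x < n → y < k → hdist x y ≡ suc j → Descent x y j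
  descent-off-cycle x y j k≤x x<n y<k e with x <? k + m
  ... | yes x<k+m = 0 , pend⁻ x k≤x x<k+m , <k⇒<n 0<k
                  , trans (hdist-cycle-cycle 0 y 0<k y<k)
                      (suc-injective (trans (sym (cong (_+ cycDist 0 y) (depth-hub-pendant x k≤x x<k+m)))
                                            (trans (sym (hdist-off-cycle x y k≤x y<k)) e)))
  ... | no  x≮k+m = k , leaf⁻ x (≮⇒≥ x≮k+m) x<n , k<n
                  , trans (trans (hdist-off-cycle k y ≤-refl y<k) (cong (λ w → depth w + cycDist 0 y) kind-hub))
                      (suc-injective (trans (sym (cong (_+ cycDist 0 y) (depth-leaf x (≮⇒≥ x≮k+m))))
                                            (trans (sym (hdist-off-cycle x y k≤x y<k)) e)))

  -- Off the cycle the distances are 1, 2 or 3 and a suitable neighbour is always v₁ or the hub.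
  descent-off-off : ∀ x y j → k ≤ x → x < n → k ≤ y → y < n → hdist x y ≡ suc j → Descent x y j
  descent-off-off x y j k≤x x<n k≤y y<n e with position x | position y
  ... | onCycle .x x<k | _ = ⊥-elim (<⇒≱ x<k k≤x)
  ... | _ | onCycle .y y<k = ⊥-elim (<⇒≱ y<k k≤y)
  ... | hub | hub rewrite kind-hub with e
  ...   | ()
  descent-off-off x y j k≤x x<n k≤y y<n e | hub | pendant .y k<y y<k+m rewrite kind-hub | kind-pendant y k<y y<k+m with e
  ... | refl = 0 , pend⁻ k ≤-refl k<k+m , <k⇒<n 0<k , subst (λ w → hdistBy w pendant 0 y ≡ 1) (sym (kind-onCycle 0 0<k)) refl
  descent-off-off x y j k≤x x<n k≤y y<n e | hub | leaf .y k+m≤y rewrite kind-hub | kind-leaf y k+m≤y with e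
  ... | refl = y , leaf⁺ y k+m≤y y<n , y<n , subst (λ w → hdistBy w leaf y y ≡ 0) (sym (kind-leaf y k+m≤y))
                                              (subst (λ w → (if w then 0 else 2) ≡ 0) (sym (≡ᵇ-refl y)) refl)
  descent-off-off x y j k≤x x<n k≤y y<n e | pendant .x k<x x<k+m | hub rewrite kind-hub | kind-pendant x k<x x<k+m with e
  ... | refl = 0 , pend⁻ x (<⇒≤ k<x) x<k+m , <k⇒<n 0<k , subst (λ w → hdistBy w hub 0 k ≡ 1) (sym (kind-onCycle 0 0<k)) refl
  descent-off-off x y j k≤x x<n k≤y y<n e | pendant .x k<x x<k+m | pendant .y k<y y<k+m
    rewrite kind-pendant x k<x x<k+m | kind-pendant y k<y y<k+m with x ≡ᵇ y | e
  ... | false | refl = 0 , pend⁻ x (<⇒≤ k<x) x<k+m , <k⇒<n 0<k , subst (λ w → hdistBy w pendant 0 y ≡ 1) (sym (kind-onCycle 0 0<k)) refl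
  descent-off-off x y j k≤x x<n k≤y y<n e | pendant .x k<x x<k+m | leaf .y k+m≤y rewrite kind-pendant x k<x x<k+m | kind-leaf y k+m≤y with e
  ... | refl = 0 , pend⁻ x (<⇒≤ k<x) x<k+m , <k⇒<n 0<k , subst (λ w → hdistBy w leaf 0 y ≡ 2) (sym (kind-onCycle 0 0<k)) refl
  descent-off-off x y j k≤x x<n k≤y y<n e | leaf .x k+m≤x | hub rewrite kind-hub | kind-leaf x k+m≤x with e
  ... | refl = k , leaf⁻ x k+m≤x x<n , k<n , subst (λ w → hdistBy w hub k k ≡ 0) (sym kind-hub) refl
  descent-off-off x y j k≤x x<n k≤y y<n e | leaf .x k+m≤x | pendant .y k<y y<k+m rewrite kind-leaf x k+m≤x | kind-pendant y k<y y<k+m with e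
  ... | refl = k , leaf⁻ x k+m≤x x<n , k<n , subst (λ w → hdistBy w pendant k y ≡ 2) (sym kind-hub) refl
  descent-off-off x y j k≤x x<n k≤y y<n e | leaf .x k+m≤x | leaf .y k+m≤y rewrite kind-leaf x k+m≤x | kind-leaf y k+m≤y with x ≡ᵇ y | e
  ... | false | refl = k , leaf⁻ x k+m≤x x<n , k<n , subst (λ w → hdistBy w leaf k y ≡ 1) (sym kind-hub) refl

  hdist-descent : ∀ x y j → x < n → y < n → hdist x y ≡ suc j → Descent x y j
  hdist-descent x y j x<n y<n e with x <? k | y <? k
  ... | yes x<k | yes y<k = descent-cycle-cycle x y j x<k y<k e
  ... | yes x<k | no  y≮k = descent-cycle-off x y j x<k (≮⇒≥ y≮k) y<n e
  ... | no  x≮k | yes y<k = descent-off-cycle x y j (≮⇒≥ x≮k) x<n y<k e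
  ... | no  x≮k | no  y≮k = descent-off-off x y j (≮⇒≥ x≮k) x<n (≮⇒≥ y≮k) y<n e

  graph : Graph
  graph = H k m t

  hdist-to : (v : Fin n) → DistanceTo graph v
  hdist-to v = record
    { φ          = λ x → hdist (toℕ x) (toℕ v)
    ; φ-target   = hdist-refl (toℕ v)
    ; φ≡0⇒target = λ x e → toℕ-injective (hdist≡0⇒≡ (toℕ x) (toℕ v) (toℕ<n x) (toℕ<n v) e)
    ; φ-edge     = λ x y e → hdist-edge (toℕ x) (toℕ y) (toℕ v) (toℕ<n v) (adj⇒Edge (toℕ x) (toℕ y) e)
    ; φ-descent  = descent
    ; φ-bounded  = λ x → hdist≤n (toℕ x) (toℕ v) (toℕ<n x) (toℕ<n v)
    }
    where
    descent : ∀ x j → hdist (toℕ x) (toℕ v) ≡ suc j →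
              ∃[ y ] (adj graph x y ≡ true) × (hdist (toℕ y) (toℕ v) ≡ j)
    descent x j e with hdist-descent (toℕ x) (toℕ v) j (toℕ<n x) (toℕ<n v) e
    ... | _ , xz , z<n , e′ = fromℕ< z<n
        , subst (λ w → adjH (toℕ x) w ≡ true) (sym (toℕ-fromℕ< z<n)) (Edge⇒adj _ _ xz)
        , subst (λ w → hdist w (toℕ v) ≡ j) (sym (toℕ-fromℕ< z<n)) e′

  dist≡hdist : ∀ (u v : Fin n) → dist graph u v ≡ hdist (toℕ u) (toℕ v)
  dist≡hdist u v = dist≡φ graph (hdist-to v) u

  ecc≡maxOf-hdist : ∀ (u : Fin n) → ecc graph u ≡ maxOf (hdist (toℕ u)) (interval 0 n)
  ecc≡maxOf-hdist u = cong (foldr _⊔_ 0) (trans (ListP.map-cong (dist≡hdist u) (allFin n))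
              (trans (ListP.map-∘ (allFin n)) (cong (map (hdist (toℕ u))) (map-toℕ-allFin n))))

  cycEcc : ℕ → ℕ
  cycEcc x = maxOf (cycDist x) (interval 0 k)
  e₀ : ℕ
  e₀ = cycEcc 0

  eccBy : Kind → ℕ → ℕ
  eccBy onCycle a = cycEcc a ⊔ (cycDist a 0 + 2)
  eccBy hub a = suc e₀
  eccBy pendant a = suc e₀ ⊔ 3
  eccBy leaf a = suc (suc e₀)

  eccH : ℕ → ℕ
  eccH a = eccBy (kind a) a

  interval-k : interval 0 k ≡ 0 ∷ interval 1 (k ∸ 1)
  interval-k = subst (λ w → interval 0 w ≡ 0 ∷ interval 1 (k ∸ 1)) 1+[k∸1]≡k refl

  cycEcc-attained : ∀ x → ∃[ y ] (y < k) × (cycDist x y ≡ cycEcc x)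
  cycEcc-attained x with maxOf-attained (cycDist x) 0 (interval 1 (k ∸ 1))
  ... | y , mem , e = y , proj₂ (∈-interval⁻ 0 k (subst (y ∈_) (sym interval-k) mem)) ,
        trans e (cong (maxOf (cycDist x)) (sym interval-k))

  cycDist≤cycEcc : ∀ x y → y < k → cycDist x y ≤ cycEcc x
  cycDist≤cycEcc x y y<k = maxOf-≥ (cycDist x) (∈-interval⁺ 0 k z≤n y<k)

  1≤e₀ : 1 ≤ e₀
  1≤e₀ = ≤-trans (≤-reflexive (sym (m≤n⇒m⊓n≡m (m+n≤o⇒m≤o∸n 1 (≤-trans (s≤s (s≤s z≤n)) 3≤k))))) (cycDist≤cycEcc 0 1 (≤-trans (s≤s (s≤s z≤n)) 3≤k))

  hdist≤maxOf : ∀ a y → y < n → hdist a y ≤ maxOf (hdist a) (interval 0 n)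
  hdist≤maxOf a y y<n = maxOf-≥ (hdist a) (∈-interval⁺ 0 n z≤n y<n)

  maxOf-hdist≤ : ∀ a B → (∀ y → y < n → hdist a y ≤ B) → maxOf (hdist a) (interval 0 n) ≤ B
  maxOf-hdist≤ a B h = maxOf-≤ (hdist a) (interval 0 n) (λ {y} mem → h y (proj₂ (∈-interval⁻ 0 n mem)))

  far : ℕ
  far = proj₁ (cycEcc-attained 0)
  far<k : far < k
  far<k = proj₁ (proj₂ (cycEcc-attained 0))
  cycDist-far : cycDist 0 far ≡ e₀
  cycDist-far = proj₂ (proj₂ (cycEcc-attained 0))

  leaf₀ : ℕ
  leaf₀ = k + m

  hdist-leaf-off≤3 : ∀ x y → k + m ≤ x → k ≤ y → hdist x y ≤ 3
  hdist-leaf-off≤3 x y l k≤y rewrite kind-leaf x l with position y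
  ... | onCycle .y y<k = ⊥-elim (<⇒≱ y<k k≤y)
  ... | hub rewrite kind-hub = s≤s z≤n
  ... | pendant .y k<y y<k+m rewrite kind-pendant y k<y y<k+m = ≤-refl
  ... | leaf .y k+m≤y rewrite kind-leaf y k+m≤y with x ≡ᵇ y
  ...   | true = z≤n
  ...   | false = s≤s (s≤s z≤n)

  leaf₀<n : leaf₀ < n
  leaf₀<n = k+m<n
  hdist-leaf₀ : ∀ a → a < k → hdist a leaf₀ ≡ cycDist a 0 + 2
  hdist-leaf₀ a a<k = trans (hdist-cycle-off a leaf₀ a<k (m≤m+n k m)) (cong (_+_ (cycDist a 0)) (depth-leaf leaf₀ ≤-refl))

  eccCycle : ∀ a → a < k → maxOf (hdist a) (interval 0 n) ≡ cycEcc a ⊔ (cycDist a 0 + 2)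
  eccCycle a a<k = ≤-antisym (maxOf-hdist≤ a _ bound) (⊔-lub cycle-part leaf-part)
    where
    bound : ∀ y → y < n → hdist a y ≤ cycEcc a ⊔ (cycDist a 0 + 2)
    bound y y<n with y <? k
    ... | yes y<k rewrite hdist-cycle-cycle a y a<k y<k = ≤-trans (cycDist≤cycEcc a y y<k) (m≤m⊔n _ _)
    ... | no  y≮k rewrite hdist-cycle-off a y a<k (≮⇒≥ y≮k) =
          ≤-trans (+-monoʳ-≤ (cycDist a 0) (proj₂ (depth-off y (≮⇒≥ y≮k)))) (m≤n⊔m _ _)
    cycle-part : cycEcc a ≤ maxOf (hdist a) (interval 0 n)
    cycle-part with cycEcc-attained a
    ... | y , y<k , e = ≤-trans (≤-reflexive (trans (sym e) (sym (hdist-cycle-cycle a y a<k y<k)))) (hdist≤maxOf a y (<k⇒<n y<k))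
    leaf-part : cycDist a 0 + 2 ≤ maxOf (hdist a) (interval 0 n)
    leaf-part = ≤-trans (≤-reflexive (sym (hdist-leaf₀ a a<k))) (hdist≤maxOf a leaf₀ leaf₀<n)

  eccHub : maxOf (hdist k) (interval 0 n) ≡ suc e₀
  eccHub = ≤-antisym (maxOf-hdist≤ k _ bound) attained
    where
    bound : ∀ y → y < n → hdist k y ≤ suc e₀
    bound y y<n with y <? k
    ... | yes y<k rewrite hdist-off-cycle k y ≤-refl y<k | kind-hub = s≤s (cycDist≤cycEcc 0 y y<k)
    ... | no  y≮k = ≤-trans (hdist-hub≤2 y (≮⇒≥ y≮k)) (s≤s 1≤e₀)
    attained : suc e₀ ≤ maxOf (hdist k) (interval 0 n)
    attained = ≤-trans (≤-reflexive (sym (trans (hdist-off-cycle k far ≤-refl far<k) (cong₂ _+_ (cong depth kind-hub) cycDist-far))))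
                       (hdist≤maxOf k far (<k⇒<n far<k))

  eccPendant : ∀ a → k < a → a < k + m → maxOf (hdist a) (interval 0 n) ≡ suc e₀ ⊔ 3
  eccPendant a k<a a<k+m = ≤-antisym (maxOf-hdist≤ a _ bound) (⊔-lub via-cycle via-leaf)
    where
    depth-a = depth-hub-pendant a (<⇒≤ k<a) a<k+m
    bound : ∀ y → y < n → hdist a y ≤ suc e₀ ⊔ 3
    bound y y<n with y <? k
    ... | yes y<k rewrite hdist-off-cycle a y (<⇒≤ k<a) y<k | depth-a = ≤-trans (s≤s (cycDist≤cycEcc 0 y y<k)) (m≤m⊔n (suc e₀) 3)
    ... | no  y≮k = ≤-trans (hdist-off≤depth+depth a y (<⇒≤ k<a) (≮⇒≥ y≮k))
                      (≤-trans (≤-reflexive (cong (_+ depth (kind y)) depth-a))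
                        (≤-trans (s≤s (proj₂ (depth-off y (≮⇒≥ y≮k)))) (m≤n⊔m (suc e₀) 3)))
    via-cycle : suc e₀ ≤ maxOf (hdist a) (interval 0 n)
    via-cycle = ≤-trans (≤-reflexive (sym (trans (hdist-off-cycle a far (<⇒≤ k<a) far<k) (cong₂ _+_ depth-a cycDist-far))))
                        (hdist≤maxOf a far (<k⇒<n far<k))
    via-leaf : 3 ≤ maxOf (hdist a) (interval 0 n)
    via-leaf = ≤-trans (≤-reflexive (sym to-leaf₀)) (hdist≤maxOf a leaf₀ leaf₀<n)
      where
      to-leaf₀ : hdist a leaf₀ ≡ 3
      to-leaf₀ rewrite kind-pendant a k<a a<k+m | kind-leaf leaf₀ ≤-refl = refl

  eccLeaf : ∀ a → k + m ≤ a → maxOf (hdist a) (interval 0 n) ≡ suc (suc e₀)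
  eccLeaf a k+m≤a = ≤-antisym (maxOf-hdist≤ a _ bound) attained
    where
    k≤a = ≤-trans (m≤m+n k m) k+m≤a
    bound : ∀ y → y < n → hdist a y ≤ suc (suc e₀)
    bound y y<n with y <? k
    ... | yes y<k rewrite hdist-off-cycle a y k≤a y<k | depth-leaf a k+m≤a = s≤s (s≤s (cycDist≤cycEcc 0 y y<k))
    ... | no  y≮k = ≤-trans (hdist-leaf-off≤3 a y k+m≤a (≮⇒≥ y≮k)) (s≤s (s≤s 1≤e₀))
    attained : suc (suc e₀) ≤ maxOf (hdist a) (interval 0 n)
    attained = ≤-trans (≤-reflexive (sym (trans (hdist-off-cycle a far k≤a far<k) (cong₂ _+_ (depth-leaf a k+m≤a) cycDist-far))))
                       (hdist≤maxOf a far (<k⇒<n far<k))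

  maxOf-hdist≡eccH : ∀ a → maxOf (hdist a) (interval 0 n) ≡ eccH a
  maxOf-hdist≡eccH a with position a
  ... | onCycle .a a<k       = trans (eccCycle a a<k) (cong (λ c → eccBy c a) (sym (kind-onCycle a a<k)))
  ... | hub                  = trans eccHub (cong (λ c → eccBy c k) (sym kind-hub))
  ... | pendant .a k<a a<k+m = trans (eccPendant a k<a a<k+m) (cong (λ c → eccBy c a) (sym (kind-pendant a k<a a<k+m)))
  ... | leaf .a k+m≤a        = trans (eccLeaf a k+m≤a) (cong (λ c → eccBy c a) (sym (kind-leaf a k+m≤a)))

  ecc≡eccH : ∀ (u : Fin n) → ecc graph u ≡ eccH (toℕ u)
  ecc≡eccH u = trans (ecc≡maxOf-hdist u) (maxOf-hdist≡eccH (toℕ u))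

-- The radicands of ABC₃(H^t(n,k;m,0,…,0))

module Radicands (k′ m′ t : ℕ) (1≤t : 1 ≤ t) where
  3≤k : 3 ≤ 3 + k′
  3≤k = s≤s (s≤s (s≤s z≤n))
  open HGraph (3 + k′) (suc m′) t 3≤k (s≤s z≤n) 1≤t public
  k m : ℕ
  k = 3 + k′
  m = suc m′

  -- The edges ab with a < b, i.e. the pairs counted by ABC3-radicands.
  data UpEdge : ℕ → ℕ → Set where
    cycleStep   : ∀ x → suc x < k → UpEdge x (suc x)
    cycleWrap   : UpEdge 0 (k ∸ 1)
    pendantEdge : ∀ y → k ≤ y → y < k + m → UpEdge 0 y
    leafEdge    : ∀ y → k + m ≤ y → y < n → UpEdge k y

  UpEdge-< : ∀ {a b} → UpEdge a b → a < b
  UpEdge-< (cycleStep x _)       = n<1+n x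
  UpEdge-< cycleWrap             = s≤s z≤n
  UpEdge-< (pendantEdge y k≤y _) = ≤-trans (s≤s z≤n) k≤y
  UpEdge-< (leafEdge y k+m≤y _)  = ≤-trans k<k+m k+m≤y

  UpEdge⇒Edge : ∀ {a b} → UpEdge a b → Edge a b
  UpEdge⇒Edge (cycleStep x 1+x<k)          = subst (Edge x) (next-suc x 1+x<k) (cyc⁺ x (<-trans (n<1+n x) 1+x<k))
  UpEdge⇒Edge cycleWrap                    = subst (λ z → Edge z (k ∸ 1)) (next-last (k ∸ 1) refl) (cyc⁻ (k ∸ 1) ≤-refl)
  UpEdge⇒Edge (pendantEdge y k≤y y<k+m)    = pend⁺ y k≤y y<k+m
  UpEdge⇒Edge (leafEdge y k+m≤y y<n)       = leaf⁺ y k+m≤y y<n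

  Edge⇒UpEdge : ∀ a b → Edge a b → a < b → UpEdge a b
  Edge⇒UpEdge _ _ (cyc⁺ x x<k) x<next with suc x <? k
  ... | yes 1+x<k rewrite next-suc x 1+x<k = cycleStep x 1+x<k
  ... | no  1+x≮k rewrite next-last x (≤-antisym x<k (≮⇒≥ 1+x≮k)) = case x<next of λ ()
  Edge⇒UpEdge _ _ (cyc⁻ x x<k) next<x with suc x <? k
  ... | yes 1+x<k rewrite next-suc x 1+x<k = ⊥-elim (<-asym next<x (n<1+n x))
  ... | no  1+x≮k with ≤-antisym x<k (≮⇒≥ 1+x≮k)
  ...   | 1+x≡k rewrite next-last x 1+x≡k = subst (UpEdge 0) (sym (cong pred 1+x≡k)) cycleWrap
  Edge⇒UpEdge _ _ (pend⁺ y k≤y y<k+m) _    = pendantEdge y k≤y y<k+m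
  Edge⇒UpEdge _ _ (pend⁻ y k≤y y<k+m) y<0  = case y<0 of λ ()
  Edge⇒UpEdge _ _ (leaf⁺ y k+m≤y y<n) _    = leafEdge y k+m≤y y<n
  Edge⇒UpEdge _ _ (leaf⁻ y k+m≤y y<n) y<k  = ⊥-elim (<-asym y<k (≤-trans k<k+m k+m≤y))

  edgeRadicand : ℕ → ℕ → List ℚ
  edgeRadicand a b = if (a <ᵇ b) ∧ adjH a b then fsq (eccH a) (eccH b) ∷ [] else []

  edgeRadicand-nil : ∀ a b → ¬ UpEdge a b → edgeRadicand a b ≡ []
  edgeRadicand-nil a b ¬ab with (a <ᵇ b) ∧ adjH a b in e
  ... | false = refl
  ... | true with ∧-true⁻ (a <ᵇ b) e
  ...   | a<b , ab = ⊥-elim (¬ab (Edge⇒UpEdge a b (adj⇒Edge a b ab) (<ᵇ-true⁻ a<b)))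

  edgeRadicand-one : ∀ a b → UpEdge a b → edgeRadicand a b ≡ fsq (eccH a) (eccH b) ∷ []
  edgeRadicand-one a b ab rewrite ∧-true⁺ (<ᵇ-true (UpEdge-< ab)) (Edge⇒adj a b (UpEdge⇒Edge ab)) = refl

  rowRadicands : ℕ → List ℚ
  rowRadicands a = concatMap (edgeRadicand a) (interval 0 n)

  radicands≡rows : ABC3-radicands graph ≡ concatMap rowRadicands (interval 0 n)
  radicands≡rows = begin
      ABC3-radicands graph
    ≡⟨ ListP.concatMap-cong (λ i → ListP.concatMap-cong (λ j → cong₂ (λ x y → if (toℕ i <ᵇ toℕ j) ∧ adjH (toℕ i) (toℕ j) then fsq x y ∷ [] else []) (ecc≡eccH i) (ecc≡eccH j)) (allFin n)) (allFin n) ⟩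
      concatMap (λ i → concatMap (λ j → edgeRadicand (toℕ i) (toℕ j)) (allFin n)) (allFin n)
    ≡⟨ ListP.concatMap-cong (λ i → sym (ListP.concatMap-map (edgeRadicand (toℕ i)) toℕ (allFin n))) (allFin n) ⟩
      concatMap (λ i → concatMap (edgeRadicand (toℕ i)) (map toℕ (allFin n))) (allFin n)
    ≡⟨ sym (ListP.concatMap-map (λ a → concatMap (edgeRadicand a) (map toℕ (allFin n))) toℕ (allFin n)) ⟩
      concatMap (λ a → concatMap (edgeRadicand a) (map toℕ (allFin n))) (map toℕ (allFin n))
    ≡⟨ cong₂ (λ l1 l2 → concatMap (λ a → concatMap (edgeRadicand a) l1) l2) (map-toℕ-allFin n) (map-toℕ-allFin n) ⟩
      concatMap rowRadicands (interval 0 n)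
    ∎
    where open ≡-Reasoning

  eccC : ℕ → ℕ
  eccC a = cycEcc a ⊔ (cycDist a 0 + 2)

  eccH-onCycle : ∀ a → a < k → eccH a ≡ eccC a
  eccH-onCycle a ak = cong (λ c → eccBy c a) (kind-onCycle a ak)

  rowRadicands-nil : ∀ a → (∀ b → ¬ UpEdge a b) → rowRadicands a ≡ []
  rowRadicands-nil a ¬up = trans (concatMap-cong-interval (edgeRadicand a) (λ _ → []) 0 n (λ b _ _ → edgeRadicand-nil a b (¬up b)))
                                 (concatMap-nil 0 n)

  segment-nil : ∀ a s l → (∀ b → s ≤ b → b < s + l → ¬ UpEdge a b) → concatMap (edgeRadicand a) (interval s l) ≡ []
  segment-nil a s l ¬up = trans (concatMap-cong-interval (edgeRadicand a) (λ _ → []) s l (λ b s≤b b<s+l → edgeRadicand-nil a b (¬up b s≤b b<s+l)))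
                                (concatMap-nil s l)

  segment-const : ∀ a s l c → (∀ b → s ≤ b → b < s + l → UpEdge a b × (eccH b ≡ c)) →
                  concatMap (edgeRadicand a) (interval s l) ≡ replicate l (fsq (eccH a) c)
  segment-const a s l c up = trans (concatMap-cong-interval (edgeRadicand a) (λ _ → fsq (eccH a) c ∷ []) s l same)
                                   (concatMap-const _ s l)
    where
    same : ∀ b → s ≤ b → b < s + l → edgeRadicand a b ≡ fsq (eccH a) c ∷ []
    same b s≤b b<s+l = trans (edgeRadicand-one a b (proj₁ (up b s≤b b<s+l))) (cong (λ e → fsq (eccH a) e ∷ []) (proj₂ (up b s≤b b<s+l)))

  rowRadicands-cycle : ∀ a → 1 ≤ a → suc a < k → rowRadicands a ≡ fsq (eccC a) (eccC (suc a)) ∷ []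
  rowRadicands-cycle a 1≤a 1+a<k = begin
      concatMap (edgeRadicand a) (interval 0 n)
    ≡⟨ cong (concatMap (edgeRadicand a)) (interval-split 0 (suc a) (n ∸ suc a) n (m+[n∸m]≡n (<⇒≤ 1+a<n))) ⟩
      concatMap (edgeRadicand a) (interval 0 (suc a) ++ interval (suc a) (n ∸ suc a))
    ≡⟨ ListP.concatMap-++ (edgeRadicand a) (interval 0 (suc a)) _ ⟩
      concatMap (edgeRadicand a) (interval 0 (suc a)) ++ concatMap (edgeRadicand a) (interval (suc a) (n ∸ suc a))
    ≡⟨ cong₂ _++_ before (cong (concatMap (edgeRadicand a) ∘′ interval (suc a)) (n<m⇒m∸n≡1+[m∸1+n] n (suc a) 1+a<n)) ⟩
      edgeRadicand a (suc a) ++ concatMap (edgeRadicand a) (interval (2 + a) (n ∸ (2 + a)))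
    ≡⟨ cong₂ _++_ (edgeRadicand-one a (suc a) (cycleStep a 1+a<k)) after ⟩
      fsq (eccH a) (eccH (suc a)) ∷ []
    ≡⟨ cong₂ (λ x y → fsq x y ∷ []) (eccH-onCycle a (<-trans (n<1+n a) 1+a<k)) (eccH-onCycle (suc a) 1+a<k) ⟩
      fsq (eccC a) (eccC (suc a)) ∷ []
    ∎
    where
    open ≡-Reasoning
    1+a<n : suc a < n
    1+a<n = <-trans 1+a<k k<n
    before : concatMap (edgeRadicand a) (interval 0 (suc a)) ≡ []
    before = segment-nil a 0 (suc a) (λ b _ b≤a up → <⇒≱ (UpEdge-< up) (≤-pred b≤a))
    ¬up : ∀ b → 2 + a ≤ b → ¬ UpEdge a b
    ¬up .(suc a) 2+a≤1+a (cycleStep .a _) = <-irrefl refl 2+a≤1+a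
    ¬up b _ (leafEdge .b _ _)             = <-irrefl refl (<-trans (n<1+n a) 1+a<k)
    ¬up .(k ∸ 1) _ cycleWrap             = <⇒≱ 1≤a z≤n
    ¬up b _ (pendantEdge .b _ _)         = <⇒≱ 1≤a z≤n
    after : concatMap (edgeRadicand a) (interval (2 + a) (n ∸ (2 + a))) ≡ []
    after = segment-nil a (2 + a) (n ∸ (2 + a)) (λ b 2+a≤b _ → ¬up b 2+a≤b)

  k′+[2+m′+t]≡1+[k′+m+t] : k′ + suc (suc m′ + t) ≡ suc (k′ + suc m′ + t)
  k′+[2+m′+t]≡1+[k′+m+t] = trans (+-suc k′ (suc m′ + t)) (cong suc (sym (+-assoc k′ (suc m′) t)))

  -- Seen from v₁ = 0 the vertices are: 0, its cycle neighbour 1, the cycle vertices 2 … k-2, its other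
  -- cycle neighbour k-1, the hub k, the remaining pendants k+1 … k+m-1 and the leaves.
  interval-v₁ : interval 2 (suc (k′ + suc m′ + t))
                ≡ interval 2 k′ ++ (2 + k′) ∷ (3 + k′) ∷ interval (4 + k′) m′ ++ interval (4 + k′ + m′) t
  interval-v₁ = trans (interval-split 2 k′ _ _ k′+[2+m′+t]≡1+[k′+m+t])
                      (cong (λ l → interval 2 k′ ++ (2 + k′) ∷ (3 + k′) ∷ l) (interval-++ (4 + k′) m′ t))

  ¬UpEdge-v₁-cycle : ∀ b → 2 ≤ b → b < 2 + k′ → ¬ UpEdge 0 b
  ¬UpEdge-v₁-cycle .1 (s≤s ()) _ (cycleStep .0 _)
  ¬UpEdge-v₁-cycle .(k ∸ 1) _ b<k-1 cycleWrap = <-irrefl refl b<k-1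
  ¬UpEdge-v₁-cycle b _ b<2+k′ (pendantEdge .b k≤b _) = <-irrefl refl (<-≤-trans b<2+k′ (≤-trans (n≤1+n _) k≤b))

  UpEdge-v₁-pendant : ∀ b → 4 + k′ ≤ b → b < 4 + k′ + m′ → UpEdge 0 b × (eccH b ≡ suc e₀ ⊔ 3)
  UpEdge-v₁-pendant b k<b b<k+m = pendantEdge b (<⇒≤ k<b) b<k+m′ , cong (λ c → eccBy c b) (kind-pendant b k<b b<k+m′)
    where
    b<k+m′ : b < k + m
    b<k+m′ = subst (b <_) (cong (_+_ 3) (sym (+-suc k′ m′))) b<k+m

  ¬UpEdge-v₁-leaf : ∀ b → 4 + k′ + m′ ≤ b → b < 4 + k′ + m′ + t → ¬ UpEdge 0 b
  ¬UpEdge-v₁-leaf .1 (s≤s ()) _ (cycleStep .0 _)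
  ¬UpEdge-v₁-leaf .(k ∸ 1) k+m≤b _ cycleWrap = <⇒≱ (s≤s (s≤s (s≤s (≤-trans (m≤m+n k′ m′) (n≤1+n _))))) k+m≤b
  ¬UpEdge-v₁-leaf b k+m≤b _ (pendantEdge .b _ b<k+m) = <⇒≱ b<k+m (subst (_≤ b) (cong (_+_ 3) (sym (+-suc k′ m′))) k+m≤b)

  private
    I₁ = interval 2 k′
    I₂ = interval (4 + k′) m′
    I₃ = interval (4 + k′ + m′) t

  rowRadicands-v₁-split : rowRadicands 0 ≡ edgeRadicand 0 0 ++ edgeRadicand 0 1 ++ concatMap (edgeRadicand 0) I₁
                                             ++ edgeRadicand 0 (2 + k′) ++ edgeRadicand 0 (3 + k′)
                                             ++ concatMap (edgeRadicand 0) I₂ ++ concatMap (edgeRadicand 0) I₃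
  rowRadicands-v₁-split =
    trans (cong (λ l → edgeRadicand 0 0 ++ edgeRadicand 0 1 ++ concatMap (edgeRadicand 0) l) interval-v₁)
          (cong (λ l → edgeRadicand 0 0 ++ edgeRadicand 0 1 ++ l)
            (trans (ListP.concatMap-++ (edgeRadicand 0) I₁ _)
                   (cong (λ l → concatMap (edgeRadicand 0) I₁ ++ edgeRadicand 0 (2 + k′) ++ edgeRadicand 0 (3 + k′) ++ l)
                         (ListP.concatMap-++ (edgeRadicand 0) I₂ I₃))))

  rowRadicands-v₁ : rowRadicands 0 ≡ fsq (eccC 0) (eccC 1) ∷ fsq (eccC 0) (eccC (2 + k′)) ∷ fsq (eccC 0) (suc e₀)
                                     ∷ replicate m′ (fsq (eccC 0) (suc e₀ ⊔ 3))
  rowRadicands-v₁ = trans rowRadicands-v₁-split pieces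
    where
    eccH-hub : eccH (3 + k′) ≡ suc e₀
    eccH-hub = cong (λ c → eccBy c k) kind-hub
    pieces : edgeRadicand 0 0 ++ edgeRadicand 0 1 ++ concatMap (edgeRadicand 0) I₁
               ++ edgeRadicand 0 (2 + k′) ++ edgeRadicand 0 (3 + k′)
               ++ concatMap (edgeRadicand 0) I₂ ++ concatMap (edgeRadicand 0) I₃
             ≡ fsq (eccC 0) (eccC 1) ∷ fsq (eccC 0) (eccC (2 + k′)) ∷ fsq (eccC 0) (suc e₀)
               ∷ replicate m′ (fsq (eccC 0) (suc e₀ ⊔ 3))
    pieces rewrite edgeRadicand-nil 0 0 (λ up → <-irrefl refl (UpEdge-< up))
                 | edgeRadicand-one 0 1 (cycleStep 0 (s≤s (s≤s z≤n)))
                 | segment-nil 0 2 k′ ¬UpEdge-v₁-cycle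
                 | edgeRadicand-one 0 (2 + k′) cycleWrap
                 | edgeRadicand-one 0 (3 + k′) (pendantEdge k ≤-refl k<k+m)
                 | segment-const 0 (4 + k′) m′ (suc e₀ ⊔ 3) UpEdge-v₁-pendant
                 | segment-nil 0 (4 + k′ + m′) t ¬UpEdge-v₁-leaf
                 | ListP.++-identityʳ (replicate m′ (fsq (eccH 0) (suc e₀ ⊔ 3)))
                 | eccH-onCycle (2 + k′) ≤-refl | eccH-hub = refl

  rowRadicands-vₖ : rowRadicands (2 + k′) ≡ []
  rowRadicands-vₖ = rowRadicands-nil (2 + k′) ¬up
    where
    ¬up : ∀ b → ¬ UpEdge (2 + k′) b
    ¬up .(suc (2 + k′)) (cycleStep .(2 + k′) k<k) = <-irrefl refl k<k

  rowRadicands-hub : rowRadicands k ≡ replicate t (fsq (suc e₀) (suc (suc e₀)))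
  rowRadicands-hub = begin
      concatMap (edgeRadicand k) (interval 0 (k + m + t))
    ≡⟨ cong (concatMap (edgeRadicand k)) (interval-++ 0 (k + m) t) ⟩
      concatMap (edgeRadicand k) (interval 0 (k + m) ++ interval (k + m) t)
    ≡⟨ ListP.concatMap-++ (edgeRadicand k) (interval 0 (k + m)) _ ⟩
      concatMap (edgeRadicand k) (interval 0 (k + m)) ++ concatMap (edgeRadicand k) (interval (k + m) t)
    ≡⟨ cong₂ _++_ (segment-nil k 0 (k + m) ¬up) (segment-const k (k + m) t (suc (suc e₀)) leaves) ⟩
      replicate t (fsq (eccH k) (suc (suc e₀)))
    ≡⟨ cong (λ c → replicate t (fsq (eccBy c k) (suc (suc e₀)))) kind-hub ⟩
      replicate t (fsq (suc e₀) (suc (suc e₀)))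
    ∎
    where
    open ≡-Reasoning
    ¬up : ∀ b → 0 ≤ b → b < 0 + (k + m) → ¬ UpEdge k b
    ¬up .(suc k) _ _ (cycleStep .k 1+k<k) = <-irrefl refl (<-trans (n<1+n k) 1+k<k)
    ¬up b _ b<k+m (leafEdge .b k+m≤b _)   = <-irrefl refl (<-≤-trans b<k+m k+m≤b)
    leaves : ∀ b → k + m ≤ b → b < k + m + t → UpEdge k b × (eccH b ≡ suc (suc e₀))
    leaves b k+m≤b b<n = leafEdge b k+m≤b b<n , cong (λ c → eccBy c b) (kind-leaf b k+m≤b)

  rowRadicands-off-cycle : concatMap rowRadicands (interval (4 + k′) (m′ + t)) ≡ []
  rowRadicands-off-cycle = trans (concatMap-cong-interval rowRadicands (λ _ → []) (4 + k′) (m′ + t)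
                                   (λ a k<a _ → rowRadicands-nil a (¬up a k<a)))
                                 (concatMap-nil (4 + k′) (m′ + t))
    where
    ¬up : ∀ a → 4 + k′ ≤ a → ∀ b → ¬ UpEdge a b
    ¬up a k<a .(suc a) (cycleStep .a 1+a<k) = <-irrefl refl (≤-trans k<a (≤-trans (n≤1+n _) (≤-trans (n≤1+n _) 1+a<k)))
    ¬up .(3 + k′) k<k b (leafEdge .b _ _) = <-irrefl refl k<k

  cycleRadicands : List ℚ
  cycleRadicands = concatMap (λ a → fsq (eccC a) (eccC (suc a)) ∷ []) (interval 1 (suc k′))

  v₁Radicands : List ℚ
  v₁Radicands = fsq (eccC 0) (eccC 1) ∷ fsq (eccC 0) (eccC (2 + k′)) ∷ fsq (eccC 0) (suc e₀) ∷ replicate m′ (fsq (eccC 0) (suc e₀ ⊔ 3))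

  radicands≡ : ABC3-radicands graph ≡ v₁Radicands ++ cycleRadicands ++ replicate t (fsq (suc e₀) (suc (suc e₀)))
  radicands≡ = begin
      ABC3-radicands graph
    ≡⟨ radicands≡rows ⟩
      rowRadicands 0 ++ concatMap rowRadicands (interval 1 (suc (suc (k′ + suc m′ + t))))
    ≡⟨ cong (λ l → rowRadicands 0 ++ concatMap rowRadicands l) (interval-split 1 (suc k′) (suc (suc m′ + t)) _ (cong suc k′+[2+m′+t]≡1+[k′+m+t])) ⟩
      rowRadicands 0 ++ concatMap rowRadicands (interval 1 (suc k′) ++ interval (2 + k′) (suc (suc m′ + t)))
    ≡⟨ cong (rowRadicands 0 ++_) (ListP.concatMap-++ rowRadicands (interval 1 (suc k′)) _) ⟩
      rowRadicands 0 ++ concatMap rowRadicands (interval 1 (suc k′)) ++ rowRadicands (2 + k′) ++ rowRadicands (3 + k′)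
        ++ concatMap rowRadicands (interval (4 + k′) (m′ + t))
    ≡⟨ cong₂ (λ x y → x ++ y ++ rowRadicands (2 + k′) ++ rowRadicands (3 + k′) ++ concatMap rowRadicands (interval (4 + k′) (m′ + t)))
         rowRadicands-v₁ (concatMap-cong-interval rowRadicands (λ a → fsq (eccC a) (eccC (suc a)) ∷ []) 1 (suc k′)
                            (λ a 1≤a a<k → rowRadicands-cycle a 1≤a (s≤s a<k))) ⟩
      v₁Radicands ++ cycleRadicands ++ rowRadicands (2 + k′) ++ rowRadicands (3 + k′) ++ concatMap rowRadicands (interval (4 + k′) (m′ + t))
    ≡⟨ cong₂ (λ x y → v₁Radicands ++ cycleRadicands ++ x ++ y) rowRadicands-vₖ (cong₂ _++_ rowRadicands-hub rowRadicands-off-cycle) ⟩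
      v₁Radicands ++ cycleRadicands ++ replicate t (fsq (suc e₀) (suc (suc e₀))) ++ []
    ≡⟨ cong (λ l → v₁Radicands ++ cycleRadicands ++ l) (ListP.++-identityʳ _) ⟩
      v₁Radicands ++ cycleRadicands ++ replicate t (fsq (suc e₀) (suc (suc e₀)))
    ∎
    where open ≡-Reasoning

-- Sums of square roots

frac : ℕ → ℕ → ℚ
frac a b = + a / suc b

private
  toℚᵘ-frac : ∀ a b → toℚᵘ (frac a b) ℚᵘ.≃ mkℚᵘ (+ a) b
  toℚᵘ-frac a b = ℚP.toℚᵘ-fromℚᵘ (mkℚᵘ (+ a) b)

frac-≤ : ∀ a b c d → a * suc d ≤ c * suc b → frac a b ℚ.≤ frac c d
frac-≤ a b c d le = ℚP.toℚᵘ-cancel-≤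
  (ℚᵘP.≤-respˡ-≃ (ℚᵘP.≃-sym (toℚᵘ-frac a b)) (ℚᵘP.≤-respʳ-≃ (ℚᵘP.≃-sym (toℚᵘ-frac c d))
    (*≤* (subst₂ ℤ._≤_ (ℤP.pos-* a (suc d)) (ℤP.pos-* c (suc b)) (+≤+ le)))))

frac-< : ∀ a b c d → a * suc d < c * suc b → frac a b ℚ.< frac c d
frac-< a b c d lt = ℚP.toℚᵘ-cancel-<
  (ℚᵘP.<-respˡ-≃ (ℚᵘP.≃-sym (toℚᵘ-frac a b)) (ℚᵘP.<-respʳ-≃ (ℚᵘP.≃-sym (toℚᵘ-frac c d))
    (*<* (subst₂ ℤ._<_ (ℤP.pos-* a (suc d)) (ℤP.pos-* c (suc b)) (+<+ lt)))))

frac-zero : ∀ b → frac 0 b ≡ 0ℚ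
frac-zero b = ℚP.≤-antisym (frac-≤ 0 b 0 0 z≤n) (frac-≤ 0 0 0 b z≤n)

frac-nonneg : ∀ a b → 0ℚ ℚ.≤ frac a b
frac-nonneg a b = subst (ℚ._≤ frac a b) (frac-zero 0) (frac-≤ 0 0 a b z≤n)

frac-* : ∀ a b c d → frac a b ℚ.* frac c d ≡ frac (a * c) (d + b * suc d)
frac-* a b c d = ℚP.toℚᵘ-injective (ℚᵘP.≃-trans (ℚP.toℚᵘ-homo-* (frac a b) (frac c d))
  (ℚᵘP.≃-trans (ℚᵘP.*-cong (toℚᵘ-frac a b) (toℚᵘ-frac c d))
    (ℚᵘP.≃-trans (ℚᵘP.≃-reflexive (cong (λ z → mkℚᵘ z (d + b * suc d)) (sym (ℤP.pos-* a c))))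
      (ℚᵘP.≃-sym (toℚᵘ-frac (a * c) (d + b * suc d))))))

frac-+ : ∀ a c b → frac a b ℚ.+ frac c b ≡ frac (a + c) b
frac-+ a c b = ℚP.toℚᵘ-injective (ℚᵘP.≃-trans (ℚP.toℚᵘ-homo-+ (frac a b) (frac c b))
  (ℚᵘP.≃-trans (ℚᵘP.+-cong (toℚᵘ-frac a b) (toℚᵘ-frac c b))
    (ℚᵘP.≃-trans (*≡* cross) (ℚᵘP.≃-sym (toℚᵘ-frac (a + c) b)))))
  where
  M = suc b
  cross : (+ a ℤ.* + M ℤ.+ + c ℤ.* + M) ℤ.* + M ≡ + (a + c) ℤ.* + (M * M)
  cross = begin
      (+ a ℤ.* + M ℤ.+ + c ℤ.* + M) ℤ.* + M
    ≡⟨ cong₂ (λ x y → (x ℤ.+ y) ℤ.* + M) (sym (ℤP.pos-* a M)) (sym (ℤP.pos-* c M)) ⟩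
      + (a * M + c * M) ℤ.* + M
    ≡⟨ sym (ℤP.pos-* (a * M + c * M) M) ⟩
      + ((a * M + c * M) * M)
    ≡⟨ cong +_ (identity a c M) ⟩
      + ((a + c) * (M * M))
    ≡⟨ ℤP.pos-* (a + c) (M * M) ⟩
      + (a + c) ℤ.* + (M * M)
    ∎
    where
    open ≡-Reasoning
    identity : ∀ a c M → (a * M + c * M) * M ≡ (a + c) * (M * M)
    identity = solve-∀

nonneg⇒frac : ∀ q → 0ℚ ℚ.≤ q → ∃[ a ] ∃[ b ] q ≡ frac a b
nonneg⇒frac (mkℚ (+ a) b c) _  = a , b , sym (ℚP.normalize-coprime c)
nonneg⇒frac (mkℚ -[1+ _ ] _ _) le with ℚ.nonNegative le
... | ()

ℚsum-↭ : ∀ {xs ys} → xs ↭ ys → ℚsum xs ≡ ℚsum ys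
ℚsum-↭ p = foldr-commMonoid (setoid ℚ) ℚP.+-0-isCommutativeMonoid (↭⇒↭ₛ p)

_≤√_ : ℚ → ℚ → Set
a ≤√ q = (0ℚ ℚ.≤ a) × (a ℚ.* a ℚ.≤ q)

_≥√_ : ℚ → ℚ → Set
b ≥√ q = (0ℚ ℚ.≤ b) × (q ℚ.≤ b ℚ.* b)

≤√-≥√⇒≤ : ∀ {a b q} → a ≤√ q → b ≥√ q → a ℚ.≤ b
≤√-≥√⇒≤ {a} {b} (0≤a , aa≤q) (0≤b , q≤bb) with a ℚ.≤? b
... | yes a≤b = a≤b
... | no  a≰b = ⊥-elim (ℚP.<-irrefl refl (ℚP.<-≤-trans bb<aa (ℚP.≤-trans aa≤q q≤bb)))
  where
  b<a = ℚP.≰⇒> a≰b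
  instance
    _ : ℚ.NonNegative b
    _ = ℚ.nonNegative 0≤b
    _ : ℚ.Positive a
    _ = ℚ.positive (ℚP.≤-<-trans 0≤b b<a)
  bb<aa : b ℚ.* b ℚ.< a ℚ.* a
  bb<aa = ℚP.≤-<-trans (ℚP.*-monoˡ-≤-nonNeg b (ℚP.<⇒≤ b<a)) (ℚP.*-monoˡ-<-pos a b<a)

ℚsum-≤√-≥√ : ∀ {as bs qs} → Pointwise _≤√_ as qs → Pointwise _≥√_ bs qs → ℚsum as ℚ.≤ ℚsum bs
ℚsum-≤√-≥√ []         []         = ℚP.≤-refl
ℚsum-≤√-≥√ (lo ∷ los) (hi ∷ his) = ℚP.+-mono-≤ (≤√-≥√⇒≤ lo hi) (ℚsum-≤√-≥√ los his)

Pointwise-↭ : ∀ {R : ℚ → ℚ → Set} {as qs qs′} → Pointwise R as qs → qs ↭ qs′ →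
              ∃[ as′ ] (as ↭ as′) × Pointwise R as′ qs′
Pointwise-↭ rs           ↭.refl         = _ , ↭.refl , rs
Pointwise-↭ (r ∷ rs)     (↭.prep _ p)   with Pointwise-↭ rs p
... | as′ , σ , rs′ = _ ∷ as′ , ↭.prep _ σ , r ∷ rs′
Pointwise-↭ (r ∷ s ∷ rs) (↭.swap _ _ p) with Pointwise-↭ rs p
... | as′ , σ , rs′ = _ , ↭.swap _ _ σ , s ∷ r ∷ rs′
Pointwise-↭ rs           (↭.trans p q)  with Pointwise-↭ rs p
... | as′ , σ , rs′ with Pointwise-↭ rs′ q
...   | as″ , τ , rs″ = as″ , ↭.trans σ τ , rs″

<√Σ-resp-↭ : ∀ {r qs qs′} → qs ↭ qs′ → r <√Σ qs → r <√Σ qs′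
<√Σ-resp-↭ p (as , los , r<Σ) with Pointwise-↭ los p
... | as′ , σ , los′ = as′ , los′ , subst (_ ℚ.<_) (ℚsum-↭ σ) r<Σ

√Σ<-resp-↭ : ∀ {r qs qs′} → qs ↭ qs′ → qs √Σ< r → qs′ √Σ< r
√Σ<-resp-↭ p (bs , his , Σ<r) with Pointwise-↭ his p
... | bs′ , σ , his′ = bs′ , his′ , subst (ℚ._< _) (ℚsum-↭ σ) Σ<r

√<-respˡ-↭ : ∀ {ps ps′ qs} → ps ↭ ps′ → ps √< qs → ps′ √< qs
√<-respˡ-↭ p (r , below , above) = r , √Σ<-resp-↭ p below , above

√<-respʳ-↭ : ∀ {ps qs qs′} → qs ↭ qs′ → ps √< qs → ps √< qs′
√<-respʳ-↭ p (r , below , above) = r , below , <√Σ-resp-↭ p above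

√Σ<-<√Σ⇒< : ∀ {r s qs} → qs √Σ< r → s <√Σ qs → s ℚ.< r
√Σ<-<√Σ⇒< (bs , his , Σb<r) (as , los , s<Σa) =
  ℚP.<-trans (ℚP.<-≤-trans s<Σa (ℚsum-≤√-≥√ los his)) Σb<r

√<-irrefl : ∀ {qs} → ¬ (qs √< qs)
√<-irrefl (r , below , above) = ℚP.<-irrefl refl (√Σ<-<√Σ⇒< below above)

√<-trans : ∀ {ps qs rs} → ps √< qs → qs √< rs → ps √< rs
√<-trans (r , below , (as , los , r<Σa)) (s , (bs , his , Σb<s) , above) =
  r , below , <√Σ-weaken above
  where
  r<s : r ℚ.< s
  r<s = √Σ<-<√Σ⇒< (bs , his , Σb<s) (as , los , r<Σa)
  <√Σ-weaken : s <√Σ _ → r <√Σ _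
  <√Σ-weaken (cs , los′ , s<Σc) = cs , los′ , ℚP.<-trans r<s s<Σc

↭⇒√≈ : ∀ {ps qs} → ps ↭ qs → ps √≈ qs
↭⇒√≈ p = (λ lt → √<-irrefl (√<-respˡ-↭ p lt)) , (λ lt → √<-irrefl (√<-respʳ-↭ p lt))

grid : ℕ → List ℕ → List ℚ
grid N = map (λ j → frac j N)

ℚsum-grid : ∀ N js → ℚsum (grid N js) ≡ frac (sum js) N
ℚsum-grid N []       = sym (frac-zero N)
ℚsum-grid N (j ∷ js) = trans (cong (frac j N ℚ.+_) (ℚsum-grid N js)) (frac-+ j (sum js) N)

last-before : ∀ (P : ℕ → Set) → (∀ j → Dec (P j)) → P 0 → ∀ B → ¬ P B → ∃[ j ] P j × ¬ P (suc j)
last-before P P? p0 zero    ¬pB = ⊥-elim (¬pB p0)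
last-before P P? p0 (suc B) ¬pB with P? B
... | yes pB = B , pB , ¬pB
... | no ¬pB′ = last-before P P? p0 B ¬pB′

-- j = ⌊(N+1) √(p/(D+1))⌋, found by search since j² (D+1) ≤ p (N+1)² fails for j = p (N+1)² + 1.
root-grid : ∀ p D N → ∃[ j ] (j * j * suc D ≤ p * (suc N * suc N))
                             × (frac j N ≤√ frac p D) × (frac (suc j) N ≥√ frac p D)
root-grid p D N with last-before Below (λ j → j * j * suc D ≤? p * (suc N * suc N)) z≤n B ¬below-B
  where
  Below : ℕ → Set
  Below j = j * j * suc D ≤ p * (suc N * suc N)
  B = suc (p * (suc N * suc N))
  ¬below-B : ¬ Below B
  ¬below-B le = <-irrefl refl
    (<-≤-trans (≤-trans (m≤m*n B (suc D)) (*-monoˡ-≤ (suc D) (m≤m*n B B))) le)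
... | j , below , ¬below = j , below
    , (frac-nonneg j N , subst (ℚ._≤ frac p D) (sym (frac-* j N j N)) (frac-≤ (j * j) (N + N * suc N) p D below))
    , (frac-nonneg (suc j) N , subst (frac p D ℚ.≤_) (sym (frac-* (suc j) N (suc j) N))
                                       (frac-≤ p D (suc j * suc j) (N + N * suc N) (<⇒≤ (≰⇒> ¬below))))

root-grid-nonneg : ∀ x → 0ℚ ℚ.≤ x → ∀ N → ∃[ j ] (frac j N ≤√ x) × (frac (suc j) N ≥√ x)
root-grid-nonneg x 0≤x N =
  let p , D , x≡p/D  = nonneg⇒frac x 0≤x
      j , _ , lo , hi = root-grid p D N
  in j , subst (frac j N ≤√_) (sym x≡p/D) lo , subst (frac (suc j) N ≥√_) (sym x≡p/D) hi

roots-grid : ∀ xs → All (0ℚ ℚ.≤_) xs → ∀ N →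
             ∃[ js ] Pointwise _≤√_ (grid N js) xs × Pointwise _≥√_ (grid N (map suc js)) xs
                     × length js ≡ length xs
roots-grid []       []           N = [] , [] , [] , refl
roots-grid (x ∷ xs) (0≤x ∷ 0≤xs) N =
  let j  , lo  , hi        = root-grid-nonneg x 0≤x N
      js , los , his , len = roots-grid xs 0≤xs N
  in j ∷ js , lo ∷ los , hi ∷ his , cong suc len

m*m≤n*n⇒m≤n : ∀ m n → m * m ≤ n * n → m ≤ n
m*m≤n*n⇒m≤n m n le with m ≤? n
... | yes m≤n = m≤n
... | no  m≰n = ⊥-elim (<⇒≱ (*-mono-< (≰⇒> m≰n) (≰⇒> m≰n)) le)

-- With q = qn/Y ≤ 1 and a/M ≤ √q we have a ≤ M, so (a+c)² ≤ a² + 3cM; the assumption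
-- 3cXY ≤ M makes this at most (qn X + 1) M²/(XY) ≤ pn M²/X, using q < p = pn/X.
shift-≤√ : ∀ a c qn pn x y M → a * a * suc y ≤ qn * (M * M) → qn ≤ suc y →
           qn * suc x < pn * suc y → 3 * c * (suc x * suc y) ≤ M →
           (a + c) * (a + c) * suc x ≤ pn * (M * M)
shift-≤√ a c qn pn x y M a²≤qM² qn≤Y q<p 3cXY≤M = *-cancelʳ-≤ _ _ Y chain
  where
  open ≤-Reasoning
  X = suc x
  Y = suc y
  a≤M : a ≤ M
  a≤M = m*m≤n*n⇒m≤n a M (*-cancelʳ-≤ (a * a) (M * M) Y
          (≤-trans a²≤qM² (≤-trans (*-monoˡ-≤ (M * M) qn≤Y) (≤-reflexive (*-comm Y (M * M))))))
  c≤M : c ≤ M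
  c≤M = ≤-trans (≤-trans (m≤m*n c (3 * (X * Y))) (≤-reflexive (reassoc c (X * Y)))) 3cXY≤M
    where
    reassoc : ∀ c z → c * (3 * z) ≡ 3 * c * z
    reassoc = solve-∀
  square : (a + c) * (a + c) ≤ a * a + 3 * c * M
  square = begin
      (a + c) * (a + c)
    ≡⟨ expand a c ⟩
      a * a + 2 * c * a + c * c
    ≤⟨ +-mono-≤ (+-monoʳ-≤ (a * a) (*-monoʳ-≤ (2 * c) a≤M)) (*-monoʳ-≤ c c≤M) ⟩
      a * a + 2 * c * M + c * M
    ≡⟨ collect a c M ⟩
      a * a + 3 * c * M
    ∎
    where
    expand : ∀ a c → (a + c) * (a + c) ≡ a * a + 2 * c * a + c * c
    expand = solve-∀
    collect : ∀ a c M → a * a + 2 * c * M + c * M ≡ a * a + 3 * c * M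
    collect = solve-∀
  chain : (a + c) * (a + c) * X * Y ≤ pn * (M * M) * Y
  chain = begin
      (a + c) * (a + c) * X * Y
    ≤⟨ *-monoˡ-≤ Y (*-monoˡ-≤ X square) ⟩
      (a * a + 3 * c * M) * X * Y
    ≡⟨ e₁ a c M X Y ⟩
      a * a * Y * X + 3 * c * (X * Y) * M
    ≤⟨ +-mono-≤ (*-monoˡ-≤ X a²≤qM²) (*-monoˡ-≤ M 3cXY≤M) ⟩
      qn * (M * M) * X + M * M
    ≡⟨ e₂ qn M X ⟩
      (qn * X + 1) * (M * M)
    ≤⟨ *-monoˡ-≤ (M * M) (≤-trans (≤-reflexive (+-comm (qn * X) 1)) q<p) ⟩
      pn * Y * (M * M)
    ≡⟨ e₃ pn Y M ⟩
      pn * (M * M) * Y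
    ∎
    where
    e₁ : ∀ a c M X Y → (a * a + 3 * c * M) * X * Y
                      ≡ a * a * Y * X + 3 * c * (X * Y) * M
    e₁ = solve-∀
    e₂ : ∀ qn M X → qn * (M * M) * X + M * M ≡ (qn * X + 1) * (M * M)
    e₂ = solve-∀
    e₃ : ∀ pn Y M → pn * Y * (M * M) ≡ pn * (M * M) * Y
    e₃ = solve-∀

sum-map-suc : ∀ js → sum (map suc js) ≡ sum js + length js
sum-map-suc []       = refl
sum-map-suc (j ∷ js) = trans (cong (_+_ (suc j)) (sum-map-suc js)) (regroup j (sum js) (length js))
  where
  regroup : ∀ j s l → suc j + (s + l) ≡ j + s + suc l
  regroup = solve-∀

-- On the grid of mesh 1/(N+1), √q is bracketed by jq and jq+1, each other entry by j and j+1;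
-- for N large the point jq + (length xs + 2) still lies below √p, which beats the accumulated error.
√<-raise-head : ∀ qn qD pn pD xs → All (0ℚ ℚ.≤_) xs → qn ≤ suc qD →
                qn * suc pD < pn * suc qD → (frac qn qD ∷ xs) √< (frac pn pD ∷ xs)
√<-raise-head qn qD pn pD xs 0≤xs q≤1 q<p = r , (bs , his , Σbs<r) , (as , los , r<Σas)
  where
  c = 2 + length xs
  N = 3 * c * (suc pD * suc qD)
  jq = proj₁ (root-grid qn qD N)
  rest = roots-grid xs 0≤xs N
  js = proj₁ rest
  bs = grid N (suc jq ∷ map suc js)
  as = grid N (jq + c ∷ js)
  his : Pointwise _≥√_ bs (frac qn qD ∷ xs)
  his = proj₂ (proj₂ (proj₂ (root-grid qn qD N))) ∷ proj₁ (proj₂ (proj₂ rest))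
  lo-p : frac (jq + c) N ≤√ frac pn pD
  lo-p = frac-nonneg (jq + c) N
       , subst (ℚ._≤ frac pn pD) (sym (frac-* (jq + c) N (jq + c) N))
           (frac-≤ ((jq + c) * (jq + c)) (N + N * suc N) pn pD (shift-≤√ jq c qn pn pD qD (suc N)
             (proj₁ (proj₂ (root-grid qn qD N))) q≤1 q<p (n≤1+n N)))
  los : Pointwise _≤√_ as (frac pn pD ∷ xs)
  los = lo-p ∷ proj₁ (proj₂ rest)
  sums : sum (suc jq ∷ map suc js) < sum (jq + c ∷ js)
  sums = ≤-reflexive (begin
      suc (suc jq + sum (map suc js))
    ≡⟨ cong (λ s → suc (suc jq + s)) (trans (sum-map-suc js) (cong (_+_ (sum js)) (proj₂ (proj₂ (proj₂ rest))))) ⟩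
      suc (suc jq + (sum js + length xs))
    ≡⟨ regroup jq (sum js) (length xs) ⟩
      jq + (2 + length xs) + sum js
    ∎)
    where
    open ≡-Reasoning
    regroup : ∀ j s l → suc (suc j + (s + l)) ≡ j + (2 + l) + s
    regroup = solve-∀
  Σbs<Σas : ℚsum bs ℚ.< ℚsum as
  Σbs<Σas = subst₂ ℚ._<_ (sym (ℚsum-grid N (suc jq ∷ map suc js))) (sym (ℚsum-grid N (jq + c ∷ js)))
              (frac-< (sum (suc jq ∷ map suc js)) N (sum (jq + c ∷ js)) N (*-monoˡ-< (suc N) sums))
  r = proj₁ (ℚP.<-dense Σbs<Σas)
  Σbs<r = proj₁ (proj₂ (ℚP.<-dense Σbs<Σas))
  r<Σas = proj₂ (proj₂ (ℚP.<-dense Σbs<Σas))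

√<-raise-replicate : ∀ qn qD pn pD t xs → All (0ℚ ℚ.≤_) xs → qn ≤ suc qD →
                     qn * suc pD < pn * suc qD →
                     (replicate (suc t) (frac qn qD) ++ xs) √< (replicate (suc t) (frac pn pD) ++ xs)
√<-raise-replicate qn qD pn pD zero    xs 0≤xs q≤1 q<p = √<-raise-head qn qD pn pD xs 0≤xs q≤1 q<p
√<-raise-replicate qn qD pn pD (suc t) xs 0≤xs q≤1 q<p =
  √<-trans (√<-raise-head qn qD pn pD _ (AllP.++⁺ (AllP.replicate⁺ (suc t) (frac-nonneg qn qD)) 0≤xs) q≤1 q<p)
    (√<-respʳ-↭ (shift p _ xs) (√<-respˡ-↭ (shift p _ xs)
      (√<-raise-replicate qn qD pn pD t (p ∷ xs) (frac-nonneg pn pD ∷ 0≤xs) q≤1 q<p)))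
  where
  p = frac pn pD

replicate-+ : ∀ {A : Set} a b (x : A) → replicate (a + b) x ≡ replicate a x ++ replicate b x
replicate-+ zero    b x = refl
replicate-+ (suc a) b x = cong (x ∷_) (replicate-+ a b x)

move-to-end : ∀ {A : Set} (xs : List A) c ys → xs ++ c ∷ ys ↭ (xs ++ ys) ++ [ c ]
move-to-end xs c ys = ↭-trans (shift c xs ys) (∷↭∷ʳ c (xs ++ ys))

∸-∸≡suc⇒ : ∀ n a b {m} → n ∸ a ∸ b ≡ suc m → n ≡ suc m + (a + b)
∸-∸≡suc⇒ n a b {m} e = begin
    n                        ≡⟨ sym (m∸n+n≡m (<⇒≤ a+b<n)) ⟩
    n ∸ (a + b) + (a + b)    ≡⟨ cong (_+ (a + b)) e′ ⟩
    suc m + (a + b)          ∎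
  where
  open ≡-Reasoning
  e′ : n ∸ (a + b) ≡ suc m
  e′ = trans (sym (∸-+-assoc n a b)) e
  a+b<n : a + b < n
  a+b<n = m∸n≢0⇒n<m (λ e″ → 0≢1+n (trans (sym e″) e′))

fsq-nonneg : ∀ x y → 0ℚ ℚ.≤ fsq x y
fsq-nonneg zero    y       = ℚP.≤-refl
fsq-nonneg (suc x) zero    = ℚP.≤-refl
fsq-nonneg (suc x) (suc y) = frac-nonneg (x + y) (y + x * suc y)

½ : ℚ
½ = + 1 / 2

-- For k = 3 the eccentricities are 2 (at v₁ and the hub) or 3, and f(2,2)² = f(2,3)² = 1/2;
-- only the edge v₂v₃ gives f(3,3).
radicands-H3 : ∀ m′ t → 1 ≤ t → ABC3-radicands (H 3 (suc m′) t) ≡ replicate (3 + m′) ½ ++ fsq 3 3 ∷ replicate t ½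
radicands-H3 m′ t 1≤t = Radicands.radicands≡ 0 m′ t 1≤t

ABC3-H3 : (n t : ℕ) → 1 ≤ t → 1 ≤ n ∸ 3 ∸ t →
          ABC3-radicands (H 3 (n ∸ 3 ∸ t) t) √≈ (replicate (n ∸ 1) ½ ++ (fsq 3 3 ∷ []))
ABC3-H3 n t 1≤t 1≤m with n ∸ 3 ∸ t in e
... | zero = contradiction 1≤m λ ()
... | suc m′ = subst₂ _√≈_ (sym (radicands-H3 m′ t 1≤t)) (cong (λ l → replicate l ½ ++ [ fsq 3 3 ]) (sym n∸1≡))
                 (↭⇒√≈ (↭-trans (move-to-end (replicate (3 + m′) ½) (fsq 3 3) (replicate t ½))
                               (↭-reflexive (cong (_++ [ fsq 3 3 ]) (sym (replicate-+ (3 + m′) t ½))))))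
  where
  n∸1≡ : n ∸ 1 ≡ 3 + m′ + t
  n∸1≡ = trans (cong (_∸ 1) (∸-∸≡suc⇒ n 3 t e)) (regroup m′ t)
    where
    regroup : ∀ m t → m + (3 + t) ≡ 3 + m + t
    regroup = solve-∀

-- fsq (suc b) (suc (suc b)) is definitionally frac (consecutive-num b) (consecutive-den b), i.e.
-- f(a, a+1)² = (2a - 1)/(a (a+1)) for a = b + 1.
consecutive-num consecutive-den : ℕ → ℕ
consecutive-num b = b + suc b
consecutive-den b = suc b + b * suc (suc b)

consecutive-num≤1+den : ∀ b → consecutive-num b ≤ suc (consecutive-den b)
consecutive-num≤1+den b = ≤-trans (+-monoˡ-≤ (suc b) (m≤m*n b (suc (suc b))))
  (≤-trans (≤-reflexive (+-comm (b * suc (suc b)) (suc b))) (n≤1+n _))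

consecutive-< : ∀ x → consecutive-num (2 + x) * suc (consecutive-den (1 + x))
                      < consecutive-num (1 + x) * suc (consecutive-den (2 + x))
consecutive-< x = ≤-trans (s≤s (m≤m+n _ (2 * x * x + 8 * x + 5))) (≤-reflexive (sym (identity x)))
  where
  identity : ∀ x → (suc x + suc (suc x)) * suc (suc (suc (suc x)) + suc (suc x) * suc (suc (suc (suc x))))
                 ≡ suc ((suc (suc x) + suc (suc (suc x))) * suc (suc (suc x) + suc x * suc (suc (suc x)))
                        + (2 * x * x + 8 * x + 5))
  identity = solve-∀

concatMap-fsq-nonneg : ∀ (f g : ℕ → ℕ) xs → All (0ℚ ℚ.≤_) (concatMap (λ a → fsq (f a) (g a) ∷ []) xs)
concatMap-fsq-nonneg f g []       = []
concatMap-fsq-nonneg f g (x ∷ xs) = fsq-nonneg (f x) (g x) ∷ concatMap-fsq-nonneg f g xs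

module _ (k″ m′ t″ : ℕ) where
  private
    k′ = suc k″
    t′ = suc t″
    module Hᵗ = Radicands k′ m′ (suc t′) (s≤s z≤n)
    module H¹ = Radicands k′ (m′ + t′) 1 (s≤s z≤n)
  open Hᵗ using (eccC; e₀; cycleRadicands; v₁Radicands; cycDist≤cycEcc)

  private
    P Q : ℚ
    P = fsq (eccC 0) (suc e₀ ⊔ 3)
    Q = fsq (suc e₀) (suc (suc e₀))
    xs : List ℚ
    xs = v₁Radicands ++ cycleRadicands ++ [ Q ]

    2≤e₀ : 2 ≤ e₀
    2≤e₀ = cycDist≤cycEcc 0 2 (s≤s (s≤s (s≤s z≤n)))
    x = e₀ ∸ 2
    e₀≡2+x : e₀ ≡ 2 + x
    e₀≡2+x = sym (trans (+-comm 2 x) (m∸n+n≡m 2≤e₀))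

    P≡ : P ≡ frac (consecutive-num (1 + x)) (consecutive-den (1 + x))
    P≡ = trans (cong₂ fsq (m≥n⇒m⊔n≡m 2≤e₀) (m≥n⇒m⊔n≡m (s≤s 2≤e₀))) (cong (λ z → fsq z (suc z)) e₀≡2+x)
    Q≡ : Q ≡ frac (consecutive-num (2 + x)) (consecutive-den (2 + x))
    Q≡ = cong (λ z → fsq (suc z) (suc (suc z))) e₀≡2+x

    xs-nonneg : All (0ℚ ℚ.≤_) xs
    xs-nonneg = fsq-nonneg (eccC 0) (eccC 1) ∷ fsq-nonneg (eccC 0) (eccC (2 + k′)) ∷ fsq-nonneg (eccC 0) (suc e₀)
              ∷ AllP.++⁺ (AllP.replicate⁺ m′ (fsq-nonneg (eccC 0) (suc e₀ ⊔ 3)))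
                  (AllP.++⁺ (concatMap-fsq-nonneg eccC (λ a → eccC (suc a)) (interval 1 (suc k′)))
                            (fsq-nonneg (suc e₀) (suc (suc e₀)) ∷ []))

    Hᵗ↭ : v₁Radicands ++ cycleRadicands ++ replicate (suc t′) Q ↭ replicate t′ Q ++ xs
    Hᵗ↭ = ↭-trans (↭-reflexive (trans (cong (v₁Radicands ++_) (sym (ListP.++-assoc cycleRadicands [ Q ] _)))
                                      (sym (ListP.++-assoc v₁Radicands _ _))))
                  (++-comm xs (replicate t′ Q))

    H¹↭ : H¹.v₁Radicands ++ cycleRadicands ++ [ Q ] ↭ replicate t′ P ++ xs
    H¹↭ = ↭-trans (↭-reflexive (cong (λ l → fsq (eccC 0) (eccC 1) ∷ fsq (eccC 0) (eccC (2 + k′)) ∷ fsq (eccC 0) (suc e₀) ∷ l)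
                    (trans (cong (_++ cycleRadicands ++ [ Q ]) (replicate-+ m′ t′ P))
                           (ListP.++-assoc (replicate m′ P) _ _))))
                  (shifts v₁Radicands (replicate t′ P))

  -- Up to order, the radicands of H^t are xs followed by t-1 copies of Q, those of H^1 are xs
  -- followed by t-1 copies of P, and Q < P.
  ABC3-Hᵗ<ABC3-H¹ : ABC3-radicands (H (3 + k′) (suc m′) (suc t′)) √< ABC3-radicands (H (3 + k′) (suc (m′ + t′)) 1)
  ABC3-Hᵗ<ABC3-H¹ =
    subst₂ _√<_ (sym Hᵗ.radicands≡) (sym H¹.radicands≡)
      (√<-respˡ-↭ (↭-sym Hᵗ↭) (√<-respʳ-↭ (↭-sym H¹↭)
        (subst₂ (λ q p → (replicate t′ q ++ xs) √< (replicate t′ p ++ xs)) (sym Q≡) (sym P≡)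
          (√<-raise-replicate (consecutive-num (2 + x)) (consecutive-den (2 + x))
                              (consecutive-num (1 + x)) (consecutive-den (1 + x)) t″ xs xs-nonneg
                              (consecutive-num≤1+den (2 + x)) (consecutive-< x)))))

suc+[a+b]∸a∸1 : ∀ m a b → suc m + (a + suc b) ∸ a ∸ 1 ≡ suc (m + b)
suc+[a+b]∸a∸1 m a b = begin
    suc m + (a + suc b) ∸ a ∸ 1  ≡⟨ cong (λ z → z ∸ a ∸ 1) (regroup m a b) ⟩
    a + (suc m + suc b) ∸ a ∸ 1  ≡⟨ cong (_∸ 1) (m+n∸m≡n a (suc m + suc b)) ⟩
    m + suc b                    ≡⟨ +-suc m b ⟩
    suc (m + b)                  ∎
  where
  open ≡-Reasoning
  regroup : ∀ m a b → suc m + (a + suc b) ≡ a + (suc m + suc b)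
  regroup = solve-∀

ABC3-H-decreasing : (n k t : ℕ) → 2 ≤ t → 4 ≤ k → 1 ≤ n ∸ k ∸ t →
                    ABC3-radicands (H k (n ∸ k ∸ t) t) √< ABC3-radicands (H k (n ∸ k ∸ 1) 1)
ABC3-H-decreasing n k@(suc (suc (suc (suc k″)))) t@(suc (suc t″)) (s≤s (s≤s z≤n)) (s≤s (s≤s (s≤s (s≤s z≤n)))) 1≤m
  with n ∸ k ∸ t in e
... | zero = contradiction 1≤m λ ()
... | suc m′ = subst (λ z → ABC3-radicands (H k (suc m′) t) √< ABC3-radicands (H k z 1)) (sym pendants)
                 (ABC3-Hᵗ<ABC3-H¹ k″ m′ t″)
  where
  pendants : n ∸ k ∸ 1 ≡ suc (m′ + suc t″)
  pendants = trans (cong (λ z → z ∸ k ∸ 1) (∸-∸≡suc⇒ n k t e)) (suc+[a+b]∸a∸1 m′ k (suc t″))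

lemma3p1 :
    ((n t : ℕ) → 1 ≤ t → 1 ≤ n ∸ 3 ∸ t →
      ABC3-radicands (H 3 (n ∸ 3 ∸ t) t)
        √≈ (replicate (n ∸ 1) ((+ 1) / 2) ++ (fsq 3 3 ∷ [])))
    ×
    ((n k t : ℕ) → 2 ≤ t → 4 ≤ k → 1 ≤ n ∸ k ∸ t →
      ABC3-radicands (H k (n ∸ k ∸ t) t)
        √< ABC3-radicands (H k (n ∸ k ∸ 1) 1))
lemma3p1 = ABC3-H3 , ABC3-H-decreasing
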